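{- For every $n\ge 3$, the number $|A^{231}(n)|$ of alternating permutations $\sigma\in A_n$ with $\sigma_3<\sigma_1<\sigma_2$ (i.e. whose prefix $\sigma_1\sigma_2\sigma_3$ is order-isomorphic to $231$) equals $nE_{n-1}-E_n$. Equivalently, for every $n\ge 3$, $|A^{231}(n)|$ is $n!$ times the coefficient of $x^n$ in $(x-1)(\sec x+\tan x)$.
   Context: A permutation $\sigma$ of $\{1,\dots,n\}$ is alternating if $\sigma_1<\sigma_2>\sigma_3<\sigma_4>\cdots$; $A_n$ is the set of such permutations. $E_n$ denotes the $n$-th Euler number, defined by $\sum_{n\ge0}E_n\frac{x^n}{n!}=\sec x+\tan x$ (so $E_n=|A_n|$). -}

module Defs where

open import Data.Nat as ℕ using (ℕ; zero; suc; _!)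
open import Data.Nat.Properties using (_!≢0)
open import Data.Integer as ℤ using (ℤ; +_)
open import Data.Rational as ℚ using (ℚ; _/_; _+_; _*_; -_; 0ℚ; 1ℚ)
open import Data.Fin as Fin using (Fin; toℕ; _<_; _<?_)
open import Data.Fin.Properties using (all?) renaming (_≟_ to _≟ᶠ_)
open import Data.Vec as Vec using (Vec; []; _∷_; lookup)
open import Data.List as List using (List; []; _∷_; length; filter; concatMap; allFin; upTo; zipWith; map; foldr)
open import Data.Product using (_×_)
open import Relation.Binary.PropositionalEquality using (_≡_)
open import Relation.Nullary using (Dec)
open import Relation.Nullary.Decidable using (_×-dec_; _→-dec_)
open import Data.Nat.Properties using () renaming (_≟_ to _≟ℕ_)

-- Permutations of {1,…,n}, encoded as words σ = σ₁ … σₙ over Fin n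
-- (value i : Fin n stands for i+1; position i : Fin n stands for i+1).

Word : ℕ → Set
Word n = Vec (Fin n) n

-- a word of length n over an n-letter alphabet is a permutation iff injective
IsPerm : ∀ {n} → Word n → Set
IsPerm {n} σ = (i j : Fin n) → lookup σ i ≡ lookup σ j → i ≡ j

isPerm? : ∀ {n} (σ : Word n) → Dec (IsPerm σ)
isPerm? σ = all? λ i → all? λ j → (lookup σ i ≟ᶠ lookup σ j) →-dec (i ≟ᶠ j)

-- Step k a b : the comparison required between positions k and k+1
-- (0-based k): ascent at even k (σ₁<σ₂, σ₃<σ₄, …), descent at odd k.
Step : ∀ {n} → ℕ → Fin n → Fin n → Set
Step zero          a b = a < b
Step (suc zero)    a b = b < a
Step (suc (suc k)) a b = Step k a b

step? : ∀ {n} k (a b : Fin n) → Dec (Step k a b)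
step? zero          a b = a <? b
step? (suc zero)    a b = b <? a
step? (suc (suc k)) a b = step? k a b

IsAlternating : ∀ {n} → Word n → Set
IsAlternating {n} σ =
  (i j : Fin n) → toℕ j ≡ suc (toℕ i) → Step (toℕ i) (lookup σ i) (lookup σ j)

isAlternating? : ∀ {n} (σ : Word n) → Dec (IsAlternating σ)
isAlternating? σ = all? λ i → all? λ j →
  (toℕ j ≟ℕ suc (toℕ i)) →-dec step? (toℕ i) (lookup σ i) (lookup σ j)

InA : ∀ {n} → Word n → Set
InA σ = IsPerm σ × IsAlternating σ

inA? : ∀ {n} (σ : Word n) → Dec (InA σ)
inA? σ = isPerm? σ ×-dec isAlternating? σ

Prefix231 : ∀ {m} → Word (3 ℕ.+ m) → Set
Prefix231 (a ∷ b ∷ c ∷ _) = (c < a) × (a < b)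

prefix231? : ∀ {m} (σ : Word (3 ℕ.+ m)) → Dec (Prefix231 σ)
prefix231? (a ∷ b ∷ c ∷ _) = (c <? a) ×-dec (a <? b)

allWords : (n k : ℕ) → List (Vec (Fin n) k)
allWords n zero    = [] ∷ []
allWords n (suc k) = concatMap (λ x → map (x ∷_) (allWords n k)) (allFin n)

cardA : ℕ → ℕ
cardA n = length (filter inA? (allWords n n))

-- |A^{231}(n)| for n = 3 + m
cardA231 : ℕ → ℕ
cardA231 m = length (filter (λ σ → inA? σ ×-dec prefix231? σ) (allWords (3 ℕ.+ m) (3 ℕ.+ m)))

sumℚ : List ℚ → ℚ
sumℚ = foldr _+_ 0ℚ

FPS : Set
FPS = ℕ → ℚ

_⊕_ : FPS → FPS → FPS
(f ⊕ g) n = f n + g n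

_⊗_ : FPS → FPS → FPS
(f ⊗ g) n = sumℚ (map (λ k → f k * g (n ℕ.∸ k)) (upTo (suc n)))

invFact : ℕ → ℚ
invFact n = ((+ 1) / (n !)) {{n !≢0}}

sign : ℕ → ℚ
sign zero    = 1ℚ
sign (suc k) = - sign k

-- cos x = Σ (-1)^k x^{2k}/(2k)!
cosS : FPS
cosS zero          = 1ℚ
cosS (suc zero)    = 0ℚ
cosS (suc (suc n)) = - cosS n * (invFact (suc (suc n)) * ((+ (n !)) / 1))

-- sin x = Σ (-1)^k x^{2k+1}/(2k+1)!  (coefficient of x^n)
sinS : FPS
sinS zero          = 0ℚ
sinS (suc zero)    = 1ℚ
sinS (suc (suc n)) = - sinS n * (invFact (suc (suc n)) * ((+ (n !)) / 1))

-- Multiplicative inverse of a series f with f₀ = 1: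
-- b₀ = 1, b_{n+1} = - Σ_{k=1}^{n+1} f_k b_{n+1-k}.
-- invList f n = [b_n, b_{n-1}, …, b_0]
invList : FPS → ℕ → List ℚ
invList f zero    = 1ℚ ∷ []
invList f (suc n) = - sumℚ (zipWith _*_ (map (λ k → f (suc k)) (upTo (suc n))) prev) ∷ prev
  where prev = invList f n

head0 : List ℚ → ℚ
head0 []      = 0ℚ
head0 (x ∷ _) = x

inv1 : FPS → FPS
inv1 f n = head0 (invList f n)

secS : FPS
secS = inv1 cosS

tanS : FPS
tanS = sinS ⊗ secS

E : ℕ → ℚ
E n = ((+ (n !)) / 1) * (secS ⊕ tanS) n

{-# OPTIONS --safe #-}

-- A pattern prescribes, for each k, whether σ_k < σ_{k+1}, σ_k > σ_{k+1}, or nothing.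
-- Classifying the permutations that obey a pattern by the position of their largest
-- letter yields a recursion for their number, from which two principles follow:
-- leaving one step free counts its "up" and "down" refinements together, and two
-- blocks of lengths s and t with no condition between them are counted by C(s+t, s)
-- times the product of the block counts.
--
-- Let D_n count the down-up permutations; complementing values shows that D_n also
-- counts the up-down (alternating) ones.  Swapping σ₁ and σ₂ identifies A^{231}(n)
-- with the permutations of pattern ↘↘↗↘…; adding the alternating ones ↗↘↗… frees the
-- first step, and a free step followed by a down-up block of length n-1 is counted by
-- n·D_{n-1}.  Hence |A^{231}(n)| = n·D_{n-1} - D_n.
--
-- It remains to see D_n = E_n.  By the same principles C(n,k)·D_{n-k} = R_{k-1} + R_{k+1},
-- where R_j counts the permutations with j initial descents followed by an up-down
-- pattern, so Σ_k (-1)^k C(n,2k)·D_{n-2k} telescopes to n!·[xⁿ](1 + sin x).  Thus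
-- (Σ D_n xⁿ/n!)·cos x = 1 + sin x, which determines sec x + tan x.

module Submission where

open import Algebra.Bundles using (CommutativeSemiring)

module RangeSum {c ℓ} (S : CommutativeSemiring c ℓ) where

  open import Data.Nat as ℕ using (ℕ; zero; suc; _∸_; _<_; _≤_)
  import Data.Nat.Properties as ℕₚ
  open import Function using (_∘_)
  import Relation.Binary.PropositionalEquality as ≡

  open CommutativeSemiring S
  open import Algebra.Properties.CommutativeSemigroup +-commutativeSemigroup using (interchange)
  open import Relation.Binary.Reasoning.Setoid setoid

  ∑ : ℕ → (ℕ → Carrier) → Carrier
  ∑ zero    f = 0#
  ∑ (suc n) f = ∑ n f + f n

  syntax ∑ n (λ j → e) = ∑[ j < n ] e

  ∑-cong : ∀ n {f g} → (∀ j → j < n → f j ≈ g j) → ∑ n f ≈ ∑ n g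
  ∑-cong zero    f≈g = refl
  ∑-cong (suc n) f≈g = +-cong (∑-cong n λ j j<n → f≈g j (ℕₚ.m<n⇒m<1+n j<n)) (f≈g n ℕₚ.≤-refl)

  ∑-0# : ∀ n → ∑[ j < n ] 0# ≈ 0#
  ∑-0# zero    = refl
  ∑-0# (suc n) = trans (+-identityʳ _) (∑-0# n)

  ∑-zero : ∀ n {f} → (∀ j → j < n → f j ≈ 0#) → ∑ n f ≈ 0#
  ∑-zero n f≈0 = trans (∑-cong n f≈0) (∑-0# n)

  ∑-head : ∀ n f → ∑ (suc n) f ≈ f 0 + ∑ n (f ∘ suc)
  ∑-head zero    f = +-comm 0# (f 0)
  ∑-head (suc n) f = begin
    ∑ (suc n) f + f (suc n)              ≈⟨ +-congʳ (∑-head n f) ⟩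
    f 0 + ∑ n (f ∘ suc) + f (suc n)      ≈⟨ +-assoc _ _ _ ⟩
    f 0 + (∑ n (f ∘ suc) + f (suc n))    ∎

  ∑-distrib-+ : ∀ n f g → ∑[ j < n ] (f j + g j) ≈ ∑ n f + ∑ n g
  ∑-distrib-+ zero    f g = sym (+-identityʳ 0#)
  ∑-distrib-+ (suc n) f g = trans (+-congʳ (∑-distrib-+ n f g)) (interchange _ _ _ _)

  ∑-distribˡ : ∀ n a f → ∑[ j < n ] (a * f j) ≈ a * ∑ n f
  ∑-distribˡ zero    a f = sym (zeroʳ a)
  ∑-distribˡ (suc n) a f = trans (+-congʳ (∑-distribˡ n a f)) (sym (distribˡ a _ _))

  ∑-distribʳ : ∀ n a f → ∑[ j < n ] (f j * a) ≈ ∑ n f * a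
  ∑-distribʳ n a f = begin
    ∑[ j < n ] (f j * a)  ≈⟨ ∑-cong n (λ j _ → *-comm (f j) a) ⟩
    ∑[ j < n ] (a * f j)  ≈⟨ ∑-distribˡ n a f ⟩
    a * ∑ n f             ≈⟨ *-comm a _ ⟩
    ∑ n f * a             ∎

  ∑-split : ∀ m n f → ∑ (m ℕ.+ n) f ≈ ∑ m f + ∑[ i < n ] f (m ℕ.+ i)
  ∑-split m zero    f = trans (reflexive (≡.cong (λ k → ∑ k f) (ℕₚ.+-identityʳ m))) (sym (+-identityʳ _))
  ∑-split m (suc n) f = begin
    ∑ (m ℕ.+ suc n) f                                ≡⟨ ≡.cong (λ k → ∑ k f) (ℕₚ.+-suc m n) ⟩
    ∑ (m ℕ.+ n) f + f (m ℕ.+ n)                      ≈⟨ +-congʳ (∑-split m n f) ⟩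
    ∑ m f + ∑[ i < n ] f (m ℕ.+ i) + f (m ℕ.+ n)     ≈⟨ +-assoc _ _ _ ⟩
    ∑ m f + ∑[ i < suc n ] f (m ℕ.+ i)               ∎

  ∑-reverse : ∀ n f → ∑ (suc n) f ≈ ∑[ k < suc n ] f (n ∸ k)
  ∑-reverse zero    f = refl
  ∑-reverse (suc n) f = begin
    ∑ (suc (suc n)) f                            ≈⟨ ∑-head (suc n) f ⟩
    f 0 + ∑ (suc n) (f ∘ suc)                    ≈⟨ +-congˡ (∑-reverse n (f ∘ suc)) ⟩
    f 0 + ∑[ k < suc n ] f (suc (n ∸ k))         ≈⟨ +-congˡ (∑-cong (suc n) λ k k<1+n →
                                                      reflexive (≡.cong f (≡.sym (ℕₚ.+-∸-assoc 1 (ℕₚ.≤-pred k<1+n))))) ⟩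
    f 0 + ∑[ k < suc n ] f (suc n ∸ k)           ≈⟨ +-comm _ _ ⟩
    ∑[ k < suc n ] f (suc n ∸ k) + f 0           ≡⟨ ≡.cong (λ i → ∑[ k < suc n ] f (suc n ∸ k) + f i) (≡.sym (ℕₚ.n∸n≡0 (suc n))) ⟩
    ∑[ k < suc (suc n) ] f (suc n ∸ k)           ∎

  ∑-triangle : ∀ n (F : ℕ → ℕ → Carrier) →
               ∑[ k < suc n ] ∑[ i < suc k ] F i k ≈ ∑[ i < suc n ] ∑[ j < suc (n ∸ i) ] F i (i ℕ.+ j)
  ∑-triangle zero    F = refl
  ∑-triangle (suc n) F = begin
    ∑[ k < suc n ] ∑[ i < suc k ] F i k + ∑[ i < suc (suc n) ] F i (suc n)
      ≈⟨ +-congʳ (∑-triangle n F) ⟩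
    ∑[ i < suc n ] ∑[ j < suc (n ∸ i) ] F i (i ℕ.+ j) + (∑[ i < suc n ] F i (suc n) + F (suc n) (suc n))
      ≈⟨ sym (+-assoc _ _ _) ⟩
    ∑[ i < suc n ] ∑[ j < suc (n ∸ i) ] F i (i ℕ.+ j) + ∑[ i < suc n ] F i (suc n) + F (suc n) (suc n)
      ≈⟨ +-congʳ (sym (∑-distrib-+ (suc n) _ _)) ⟩
    ∑[ i < suc n ] (∑[ j < suc (n ∸ i) ] F i (i ℕ.+ j) + F i (suc n)) + F (suc n) (suc n)
      ≈⟨ +-cong (∑-cong (suc n) extend) lastRow ⟩
    ∑[ i < suc (suc n) ] ∑[ j < suc (suc n ∸ i) ] F i (i ℕ.+ j)
      ∎
    where
    extend : ∀ i → i < suc n →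
             ∑[ j < suc (n ∸ i) ] F i (i ℕ.+ j) + F i (suc n) ≈ ∑[ j < suc (suc n ∸ i) ] F i (i ℕ.+ j)
    extend i i<1+n = begin
      ∑[ j < suc (n ∸ i) ] F i (i ℕ.+ j) + F i (suc n)
        ≡⟨ ≡.cong (λ k → ∑[ j < suc (n ∸ i) ] F i (i ℕ.+ j) + F i k) (≡.sym i+[1+n∸i]≡1+n) ⟩
      ∑[ j < suc (suc (n ∸ i)) ] F i (i ℕ.+ j)
        ≡⟨ ≡.cong (λ k → ∑[ j < suc k ] F i (i ℕ.+ j)) (≡.sym (ℕₚ.+-∸-assoc 1 i≤n)) ⟩
      ∑[ j < suc (suc n ∸ i) ] F i (i ℕ.+ j) ∎
      where
      i≤n = ℕₚ.≤-pred i<1+n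
      i+[1+n∸i]≡1+n : i ℕ.+ suc (n ∸ i) ≡.≡ suc n
      i+[1+n∸i]≡1+n = ≡.trans (ℕₚ.+-suc i (n ∸ i)) (≡.cong suc (ℕₚ.m+[n∸m]≡n i≤n))
    lastRow : F (suc n) (suc n) ≈ ∑[ j < suc (suc n ∸ suc n) ] F (suc n) (suc n ℕ.+ j)
    lastRow rewrite ℕₚ.n∸n≡0 n | ℕₚ.+-identityʳ n = sym (+-identityˡ _)

module Patterns where

  open import Data.Nat using (ℕ; zero; suc; _+_; _*_; _∸_; _<_; _≤_; z≤n; s≤s)
  open import Data.Nat.Properties
  open import Data.Nat.Combinatorics using (_C_; k>n⇒nCk≡0; nCk+nC[k+1]≡[n+1]C[k+1])
  open import Data.Nat.Tactic.RingSolver using (solve-∀)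
  open import Data.Sum using (_⊎_; inj₁; inj₂)
  open import Data.Product using (_,_)
  open import Function using (_∘_)
  open import Relation.Binary.PropositionalEquality
  open RangeSum +-*-commutativeSemiring using (∑; ∑-cong; ∑-zero; ∑-head; ∑-split; ∑-distribˡ; ∑-distribʳ)

  data Constraint : Set where
    up down free : Constraint

  Pattern : Set
  Pattern = ℕ → Constraint

  infixr 5 _∷ᵖ_

  _∷ᵖ_ : Constraint → Pattern → Pattern
  (x ∷ᵖ c) zero    = x
  (x ∷ᵖ c) (suc k) = c k

  tailᵖ : Pattern → Pattern
  tailᵖ c = c ∘ suc

  infixl 6 _[_]≔_

  _[_]≔_ : Pattern → ℕ → Constraint → Pattern
  c [ zero  ]≔ x = x ∷ᵖ tailᵖ c
  c [ suc k ]≔ x = c 0 ∷ᵖ tailᵖ c [ k ]≔ x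

  -- glue c s d constrains the first s letters by c and the remaining ones by d, with no
  -- condition between the two blocks.

  glue : Pattern → ℕ → Pattern → Pattern
  glue c zero          d = d
  glue c (suc zero)    d = free ∷ᵖ d
  glue c (suc (suc s)) d = c 0 ∷ᵖ glue (tailᵖ c) (suc s) d

  -- The constraints left on a word once its letter at position j is deleted: the two
  -- constraints adjacent to that letter merge into a free one.

  removeᵖ : Pattern → ℕ → Pattern
  removeᵖ c zero          = tailᵖ c
  removeᵖ c (suc zero)    = free ∷ᵖ tailᵖ (tailᵖ c)
  removeᵖ c (suc (suc j)) = c 0 ∷ᵖ removeᵖ (tailᵖ c) (suc j)

  decreasing : Pattern
  decreasing _ = down

  upDown : Pattern
  upDown zero          = up
  upDown (suc zero)    = down
  upDown (suc (suc k)) = upDown k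

  downUp : Pattern
  downUp = tailᵖ upDown

  upDown≗up∷downUp : upDown ≗ up ∷ᵖ downUp
  upDown≗up∷downUp zero    = refl
  upDown≗up∷downUp (suc k) = refl

  flip : Constraint → Constraint
  flip up   = down
  flip down = up
  flip free = free

  flip-involutive : ∀ x → flip (flip x) ≡ x
  flip-involutive up   = refl
  flip-involutive down = refl
  flip-involutive free = refl

  flip-upDown : flip ∘ upDown ≗ downUp
  flip-upDown zero          = refl
  flip-upDown (suc zero)    = refl
  flip-upDown (suc (suc k)) = flip-upDown k

  -- count c n is the number of permutations of length n obeying c, classified by the
  -- position j of their largest letter: it can sit at j exactly when the constraints on
  -- both sides of j allow a peak (maxFitsLeft/Right are 0/1-valued indicators), and
  -- deleting it leaves a permutation obeying removeᵖ c j.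

  ascentOK : Constraint → ℕ
  ascentOK down = 0
  ascentOK _    = 1

  descentOK : Constraint → ℕ
  descentOK up = 0
  descentOK _  = 1

  maxFitsLeft : Pattern → ℕ → ℕ
  maxFitsLeft c zero    = 1
  maxFitsLeft c (suc j) = ascentOK (c j)

  maxFitsRight : Pattern → ℕ → ℕ → ℕ
  maxFitsRight c zero    zero    = 1
  maxFitsRight c zero    (suc j) = 0
  maxFitsRight c (suc n) zero    = descentOK (c zero)
  maxFitsRight c (suc n) (suc j) = maxFitsRight (tailᵖ c) n j

  mutual
    count : Pattern → ℕ → ℕ
    count c zero    = 1
    count c (suc n) = ∑[ j < suc n ] countMaxAt c n j

    countMaxAt : Pattern → ℕ → ℕ → ℕ
    countMaxAt c n j = maxFitsLeft c j * maxFitsRight c n j * count (removeᵖ c j) n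

  ascentOK-01 : ∀ x → ascentOK x ≡ 0 ⊎ ascentOK x ≡ 1
  ascentOK-01 up   = inj₂ refl
  ascentOK-01 down = inj₁ refl
  ascentOK-01 free = inj₂ refl

  descentOK-01 : ∀ x → descentOK x ≡ 0 ⊎ descentOK x ≡ 1
  descentOK-01 up   = inj₁ refl
  descentOK-01 down = inj₂ refl
  descentOK-01 free = inj₂ refl

  maxFitsLeft-01 : ∀ c j → maxFitsLeft c j ≡ 0 ⊎ maxFitsLeft c j ≡ 1
  maxFitsLeft-01 c zero    = inj₂ refl
  maxFitsLeft-01 c (suc j) = ascentOK-01 (c j)

  maxFitsRight-01 : ∀ c n j → maxFitsRight c n j ≡ 0 ⊎ maxFitsRight c n j ≡ 1
  maxFitsRight-01 c zero    zero    = inj₂ refl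
  maxFitsRight-01 c zero    (suc j) = inj₁ refl
  maxFitsRight-01 c (suc n) zero    = descentOK-01 (c zero)
  maxFitsRight-01 c (suc n) (suc j) = maxFitsRight-01 (tailᵖ c) n j

  maxFitsRight-last : ∀ c n → maxFitsRight c n n ≡ 1
  maxFitsRight-last c zero    = refl
  maxFitsRight-last c (suc n) = maxFitsRight-last (tailᵖ c) n

  maxFitsRight-inner : ∀ c n j → j < n → maxFitsRight c n j ≡ descentOK (c j)
  maxFitsRight-inner c (suc zero)    zero    _           = refl
  maxFitsRight-inner c (suc (suc n)) zero    _           = refl
  maxFitsRight-inner c (suc n)       (suc j) (s≤s j<n)   = maxFitsRight-inner (tailᵖ c) n j j<n

  []≔-unchanged : ∀ c k x → c k ≡ x → c [ k ]≔ x ≗ c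
  []≔-unchanged c zero    x ck≡x zero    = sym ck≡x
  []≔-unchanged c zero    x ck≡x (suc i) = refl
  []≔-unchanged c (suc k) x ck≡x zero    = refl
  []≔-unchanged c (suc k) x ck≡x (suc i) = []≔-unchanged (tailᵖ c) k x ck≡x i

  glue-prefix : ∀ c s d k → suc k < s → glue c s d k ≡ c k
  glue-prefix c (suc zero)    d zero    (s≤s ())
  glue-prefix c (suc (suc s)) d zero    _             = refl
  glue-prefix c (suc (suc s)) d (suc k) (s≤s 1+k<1+s) = glue-prefix (tailᵖ c) (suc s) d k 1+k<1+s

  glue-gap : ∀ c d k → glue c (suc k) d k ≡ free
  glue-gap c d zero    = refl
  glue-gap c d (suc k) = glue-gap (tailᵖ c) d k

  glue-suffix : ∀ c s d i → glue c s d (s + i) ≡ d i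
  glue-suffix c zero          d i = refl
  glue-suffix c (suc zero)    d i = refl
  glue-suffix c (suc (suc s)) d i = glue-suffix (tailᵖ c) (suc s) d i

  tailᵖ-glue : ∀ c s d k → glue c (suc s) d (suc k) ≡ glue (tailᵖ c) s d k
  tailᵖ-glue c zero    d k = refl
  tailᵖ-glue c (suc s) d k = refl

  glue-congˡ : ∀ {c c′} s d → c ≗ c′ → glue c s d ≗ glue c′ s d
  glue-congˡ zero          d c≗c′ k       = refl
  glue-congˡ (suc zero)    d c≗c′ k       = refl
  glue-congˡ (suc (suc s)) d c≗c′ zero    = c≗c′ 0
  glue-congˡ (suc (suc s)) d c≗c′ (suc k) = glue-congˡ (suc s) d (c≗c′ ∘ suc) k

  removeᵖ-cong : ∀ {c c′} j → c ≗ c′ → removeᵖ c j ≗ removeᵖ c′ j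
  removeᵖ-cong zero          c≗c′ k       = c≗c′ (suc k)
  removeᵖ-cong (suc zero)    c≗c′ zero    = refl
  removeᵖ-cong (suc zero)    c≗c′ (suc k) = c≗c′ (suc (suc k))
  removeᵖ-cong (suc (suc j)) c≗c′ zero    = c≗c′ 0
  removeᵖ-cong (suc (suc j)) c≗c′ (suc k) = removeᵖ-cong (suc j) (c≗c′ ∘ suc) k

  tailᵖ-removeᵖ : ∀ c j k → removeᵖ c (suc j) (suc k) ≡ removeᵖ (tailᵖ c) j k
  tailᵖ-removeᵖ c zero    k = refl
  tailᵖ-removeᵖ c (suc j) k = refl

  AgreeBelow : ℕ → Pattern → Pattern → Set
  AgreeBelow n c c′ = ∀ k → k < n → c k ≡ c′ k

  removeᵖ-local : ∀ {c c′} j n → AgreeBelow (suc n) c c′ → AgreeBelow n (removeᵖ c j) (removeᵖ c′ j)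
  removeᵖ-local zero          n       c≡c′ k       k<n       = c≡c′ (suc k) (s≤s k<n)
  removeᵖ-local (suc zero)    n       c≡c′ zero    _         = refl
  removeᵖ-local (suc zero)    n       c≡c′ (suc k) 1+k<n     = c≡c′ (suc (suc k)) (s≤s 1+k<n)
  removeᵖ-local (suc (suc j)) n       c≡c′ zero    _         = c≡c′ 0 (s≤s z≤n)
  removeᵖ-local (suc (suc j)) (suc n) c≡c′ (suc k) (s≤s k<n) =
    removeᵖ-local (suc j) n (λ k k<1+n → c≡c′ (suc k) (s≤s k<1+n)) k k<n

  maxFitsLeft-local : ∀ {c c′} n j → j ≤ n → AgreeBelow n c c′ → maxFitsLeft c j ≡ maxFitsLeft c′ j
  maxFitsLeft-local n zero    _     c≡c′ = refl
  maxFitsLeft-local n (suc j) 1+j≤n c≡c′ = cong ascentOK (c≡c′ j 1+j≤n)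

  maxFitsRight-local : ∀ {c c′} n j → j ≤ n → AgreeBelow n c c′ → maxFitsRight c n j ≡ maxFitsRight c′ n j
  maxFitsRight-local {c} {c′} n j j≤n c≡c′ with m≤n⇒m<n∨m≡n j≤n
  ... | inj₁ j<n  = trans (maxFitsRight-inner c n j j<n)
                      (trans (cong descentOK (c≡c′ j j<n)) (sym (maxFitsRight-inner c′ n j j<n)))
  ... | inj₂ refl = trans (maxFitsRight-last c n) (sym (maxFitsRight-last c′ n))

  count-local : ∀ n {c c′} → AgreeBelow n c c′ → count c (suc n) ≡ count c′ (suc n)
  count-local n {c} {c′} c≡c′ = ∑-cong (suc n) λ j j<1+n →
    cong₂ _*_ (cong₂ _*_ (maxFitsLeft-local n j (≤-pred j<1+n) c≡c′) (maxFitsRight-local n j (≤-pred j<1+n) c≡c′))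
              (afterRemoval n j c≡c′)
    where
    afterRemoval : ∀ n j → AgreeBelow n c c′ → count (removeᵖ c j) n ≡ count (removeᵖ c′ j) n
    afterRemoval zero    j _    = refl
    afterRemoval (suc n) j c≡c′ = count-local n (removeᵖ-local j n c≡c′)

  count-cong : ∀ n {c c′} → c ≗ c′ → count c n ≡ count c′ n
  count-cong zero    c≗c′ = refl
  count-cong (suc n) c≗c′ = count-local n (λ k _ → c≗c′ k)

  count-decreasing : ∀ n → count decreasing n ≡ 1
  count-decreasing zero    = refl
  count-decreasing (suc n) = begin
    ∑ (suc n) (countMaxAt decreasing n)                              ≡⟨ ∑-head n (countMaxAt decreasing n) ⟩
    countMaxAt decreasing n 0 + ∑[ j < n ] countMaxAt decreasing n (suc j)
      ≡⟨ cong₂ _+_ (maxFirst n) (∑-zero n (λ _ _ → refl)) ⟩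
    1 ∎
    where
    open ≡-Reasoning
    maxFirst : ∀ n → countMaxAt decreasing n 0 ≡ 1
    maxFirst zero    = refl
    maxFirst (suc n) = trans (+-identityʳ _) (count-decreasing (suc n))

  removeᵖ-glue-prefix : ∀ j s c d → j ≤ s → removeᵖ (glue c (suc s) d) j ≗ glue (removeᵖ c j) s d
  removeᵖ-glue-prefix zero          s             c d _         k       = tailᵖ-glue c s d k
  removeᵖ-glue-prefix (suc zero)    (suc zero)    c d _         zero    = refl
  removeᵖ-glue-prefix (suc zero)    (suc (suc s)) c d _         zero    = refl
  removeᵖ-glue-prefix (suc (suc j)) (suc zero)    c d (s≤s ())  zero
  removeᵖ-glue-prefix (suc (suc j)) (suc (suc s)) c d _         zero    = refl
  removeᵖ-glue-prefix (suc j)       (suc s)       c d (s≤s j≤s) (suc k) = begin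
    removeᵖ (glue c (suc (suc s)) d) (suc j) (suc k)   ≡⟨ tailᵖ-removeᵖ (glue c (suc (suc s)) d) j k ⟩
    removeᵖ (glue (tailᵖ c) (suc s) d) j k             ≡⟨ removeᵖ-glue-prefix j s (tailᵖ c) d j≤s k ⟩
    glue (removeᵖ (tailᵖ c) j) s d k                   ≡⟨ glue-congˡ s d (sym ∘ tailᵖ-removeᵖ c j) k ⟩
    glue (tailᵖ (removeᵖ c (suc j))) s d k             ≡⟨ sym (tailᵖ-glue (removeᵖ c (suc j)) s d k) ⟩
    glue (removeᵖ c (suc j)) (suc s) d (suc k)         ∎
    where open ≡-Reasoning

  removeᵖ-glue-suffix : ∀ s i c d → removeᵖ (glue c s d) (s + i) ≗ glue c s (removeᵖ d i)
  removeᵖ-glue-suffix zero          i       c d k       = refl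
  removeᵖ-glue-suffix (suc zero)    zero    c d zero    = refl
  removeᵖ-glue-suffix (suc zero)    (suc i) c d zero    = refl
  removeᵖ-glue-suffix (suc (suc s)) i       c d zero    = refl
  removeᵖ-glue-suffix (suc s)       i       c d (suc k) = begin
    removeᵖ (glue c (suc s) d) (suc (s + i)) (suc k)   ≡⟨ tailᵖ-removeᵖ (glue c (suc s) d) (s + i) k ⟩
    removeᵖ (tailᵖ (glue c (suc s) d)) (s + i) k       ≡⟨ removeᵖ-cong (s + i) (tailᵖ-glue c s d) k ⟩
    removeᵖ (glue (tailᵖ c) s d) (s + i) k             ≡⟨ removeᵖ-glue-suffix s i (tailᵖ c) d k ⟩
    glue (tailᵖ c) s (removeᵖ d i) k                   ≡⟨ sym (tailᵖ-glue c s (removeᵖ d i) k) ⟩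
    glue c (suc s) (removeᵖ d i) (suc k)               ∎
    where open ≡-Reasoning

  maxFitsLeft-glue-prefix : ∀ c s d j → j < s → maxFitsLeft (glue c s d) j ≡ maxFitsLeft c j
  maxFitsLeft-glue-prefix c s d zero    _     = refl
  maxFitsLeft-glue-prefix c s d (suc j) 1+j<s = cong ascentOK (glue-prefix c s d j 1+j<s)

  maxFitsLeft-glue-suffix : ∀ c s d i → maxFitsLeft (glue c s d) (s + i) ≡ maxFitsLeft d i
  maxFitsLeft-glue-suffix c zero    d i       = refl
  maxFitsLeft-glue-suffix c (suc s) d zero    =
    cong ascentOK (trans (cong (glue c (suc s) d) (+-identityʳ s)) (glue-gap c d s))
  maxFitsLeft-glue-suffix c (suc s) d (suc i) =
    cong ascentOK (trans (cong (glue c (suc s) d) (+-suc s i)) (glue-suffix c (suc s) d i))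

  maxFitsRight-glue-prefix : ∀ c s d t j → j ≤ s → maxFitsRight (glue c (suc s) d) (s + t) j ≡ maxFitsRight c s j
  maxFitsRight-glue-prefix c s d t j j≤s with m≤n⇒m<n∨m≡n j≤s
  ... | inj₁ j<s = begin
    maxFitsRight (glue c (suc s) d) (s + t) j   ≡⟨ maxFitsRight-inner _ (s + t) j (≤-trans j<s (m≤m+n s t)) ⟩
    descentOK (glue c (suc s) d j)              ≡⟨ cong descentOK (glue-prefix c (suc s) d j (s≤s j<s)) ⟩
    descentOK (c j)                             ≡⟨ sym (maxFitsRight-inner c s j j<s) ⟩
    maxFitsRight c s j                          ∎
    where open ≡-Reasoning
  maxFitsRight-glue-prefix c s d zero    _ _ | inj₂ refl = begin
    maxFitsRight (glue c (suc s) d) (s + 0) s   ≡⟨ cong (λ n → maxFitsRight (glue c (suc s) d) n s) (+-identityʳ s) ⟩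
    maxFitsRight (glue c (suc s) d) s s         ≡⟨ maxFitsRight-last _ s ⟩
    1                                           ≡⟨ sym (maxFitsRight-last c s) ⟩
    maxFitsRight c s s                          ∎
    where open ≡-Reasoning
  maxFitsRight-glue-prefix c s d (suc t) _ _ | inj₂ refl = begin
    maxFitsRight (glue c (suc s) d) (s + suc t) s   ≡⟨ maxFitsRight-inner _ (s + suc t) s (m<m+n s (s≤s z≤n)) ⟩
    descentOK (glue c (suc s) d s)                  ≡⟨ cong descentOK (glue-gap c d s) ⟩
    1                                               ≡⟨ sym (maxFitsRight-last c s) ⟩
    maxFitsRight c s s                              ∎
    where open ≡-Reasoning

  maxFitsRight-glue-suffix : ∀ c s d t i → i ≤ t → maxFitsRight (glue c s d) (s + t) (s + i) ≡ maxFitsRight d t i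
  maxFitsRight-glue-suffix c s d t i i≤t with m≤n⇒m<n∨m≡n i≤t
  ... | inj₁ i<t = begin
    maxFitsRight (glue c s d) (s + t) (s + i)   ≡⟨ maxFitsRight-inner _ (s + t) (s + i) (+-monoʳ-< s i<t) ⟩
    descentOK (glue c s d (s + i))              ≡⟨ cong descentOK (glue-suffix c s d i) ⟩
    descentOK (d i)                             ≡⟨ sym (maxFitsRight-inner d t i i<t) ⟩
    maxFitsRight d t i                          ∎
    where open ≡-Reasoning
  ... | inj₂ refl = trans (maxFitsRight-last _ (s + i)) (sym (maxFitsRight-last d i))

  private
    pull-prefix : ∀ a b k x y → a * b * (k * (x * y)) ≡ k * (a * b * x * y)
    pull-prefix = solve-∀

    pull-suffix : ∀ a b k x y → a * b * (k * (x * y)) ≡ k * (x * (a * b * y))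
    pull-suffix = solve-∀

  module _ (s t : ℕ) (c d : Pattern) where

    countMaxAt-glue-prefix : ∀ j → j ≤ s →
      count (glue (removeᵖ c j) s d) (s + t) ≡ ((s + t) C s) * (count (removeᵖ c j) s * count d t) →
      countMaxAt (glue c (suc s) d) (s + t) j ≡ ((s + t) C s) * (countMaxAt c s j * count d t)
    countMaxAt-glue-prefix j j≤s ih = begin
      maxFitsLeft G j * maxFitsRight G (s + t) j * count (removeᵖ G j) (s + t)
        ≡⟨ cong₂ (λ x y → x * y * count (removeᵖ G j) (s + t))
             (maxFitsLeft-glue-prefix c (suc s) d j (s≤s j≤s)) (maxFitsRight-glue-prefix c s d t j j≤s) ⟩
      maxFitsLeft c j * maxFitsRight c s j * count (removeᵖ G j) (s + t)
        ≡⟨ cong (maxFitsLeft c j * maxFitsRight c s j *_)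
             (trans (count-cong (s + t) (removeᵖ-glue-prefix j s c d j≤s)) ih) ⟩
      maxFitsLeft c j * maxFitsRight c s j * (((s + t) C s) * (count (removeᵖ c j) s * count d t))
        ≡⟨ pull-prefix (maxFitsLeft c j) (maxFitsRight c s j) ((s + t) C s) (count (removeᵖ c j) s) (count d t) ⟩
      ((s + t) C s) * (maxFitsLeft c j * maxFitsRight c s j * count (removeᵖ c j) s * count d t)
        ∎
      where
      open ≡-Reasoning
      G = glue c (suc s) d

    countMaxAt-glue-suffix : ∀ i → i ≤ t →
      count (glue c s (removeᵖ d i)) (s + t) ≡ ((s + t) C s) * (count c s * count (removeᵖ d i) t) →
      countMaxAt (glue c s d) (s + t) (s + i) ≡ ((s + t) C s) * (count c s * countMaxAt d t i)
    countMaxAt-glue-suffix i i≤t ih = begin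
      maxFitsLeft G (s + i) * maxFitsRight G (s + t) (s + i) * count (removeᵖ G (s + i)) (s + t)
        ≡⟨ cong₂ (λ x y → x * y * count (removeᵖ G (s + i)) (s + t))
             (maxFitsLeft-glue-suffix c s d i) (maxFitsRight-glue-suffix c s d t i i≤t) ⟩
      maxFitsLeft d i * maxFitsRight d t i * count (removeᵖ G (s + i)) (s + t)
        ≡⟨ cong (maxFitsLeft d i * maxFitsRight d t i *_)
             (trans (count-cong (s + t) (removeᵖ-glue-suffix s i c d)) ih) ⟩
      maxFitsLeft d i * maxFitsRight d t i * (((s + t) C s) * (count c s * count (removeᵖ d i) t))
        ≡⟨ pull-suffix (maxFitsLeft d i) (maxFitsRight d t i) ((s + t) C s) (count c s) (count (removeᵖ d i) t) ⟩
      ((s + t) C s) * (count c s * (maxFitsLeft d i * maxFitsRight d t i * count (removeᵖ d i) t))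
        ∎
      where
      open ≡-Reasoning
      G = glue c s d

  -- The largest letter lies in one of the two blocks; removing it and recursing gives
  -- the two halves of Pascal's rule.
  count-glue : ∀ s t c d → count (glue c s d) (s + t) ≡ ((s + t) C s) * (count c s * count d t)
  count-glue zero    zero    c d = refl
  count-glue zero    (suc t) c d = sym (trans (*-identityˡ (1 * count d (suc t))) (*-identityˡ (count d (suc t))))
  count-glue (suc s) t       c d = begin
    ∑ (suc s + t) (countMaxAt G (s + t))
      ≡⟨ ∑-split (suc s) t _ ⟩
    ∑ (suc s) (countMaxAt G (s + t)) + ∑[ i < t ] countMaxAt G (s + t) (suc s + i)
      ≡⟨ cong₂ _+_ prefixPeaks (suffixPeaks t) ⟩
    ((s + t) C s) * X + ((s + t) C suc s) * X
      ≡⟨ sym (*-distribʳ-+ X ((s + t) C s) _) ⟩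
    ((s + t) C s + (s + t) C suc s) * X
      ≡⟨ cong (_* X) (nCk+nC[k+1]≡[n+1]C[k+1] (s + t) s) ⟩
    (suc (s + t) C suc s) * X
      ∎
    where
    open ≡-Reasoning
    G = glue c (suc s) d
    X = count c (suc s) * count d t

    prefixPeaks : ∑ (suc s) (countMaxAt G (s + t)) ≡ ((s + t) C s) * X
    prefixPeaks = begin
      ∑[ j < suc s ] countMaxAt G (s + t) j
        ≡⟨ ∑-cong (suc s) (λ j j<1+s → countMaxAt-glue-prefix s t c d j (≤-pred j<1+s)
                                          (count-glue s t (removeᵖ c j) d)) ⟩
      ∑[ j < suc s ] (((s + t) C s) * (countMaxAt c s j * count d t))
        ≡⟨ ∑-distribˡ (suc s) ((s + t) C s) (λ j → countMaxAt c s j * count d t) ⟩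
      ((s + t) C s) * ∑[ j < suc s ] (countMaxAt c s j * count d t)
        ≡⟨ cong (((s + t) C s) *_) (∑-distribʳ (suc s) (count d t) (countMaxAt c s)) ⟩
      ((s + t) C s) * X ∎

    suffixPeaks : ∀ t → ∑[ i < t ] countMaxAt G (s + t) (suc s + i) ≡ ((s + t) C suc s) * (count c (suc s) * count d t)
    suffixPeaks zero = sym (cong (_* (count c (suc s) * 1)) (k>n⇒nCk≡0 (s≤s (≤-reflexive (+-identityʳ s)))))
    suffixPeaks (suc t) = begin
      ∑[ i < suc t ] countMaxAt G (s + suc t) (suc s + i)
        ≡⟨ ∑-cong (suc t) (λ i i<1+t → trans (cong (λ n → countMaxAt G n (suc s + i)) (+-suc s t))
             (countMaxAt-glue-suffix (suc s) t c d i (≤-pred i<1+t) (count-glue (suc s) t c (removeᵖ d i)))) ⟩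
      ∑[ i < suc t ] (((suc s + t) C suc s) * (count c (suc s) * countMaxAt d t i))
        ≡⟨ ∑-distribˡ (suc t) ((suc s + t) C suc s) (λ i → count c (suc s) * countMaxAt d t i) ⟩
      ((suc s + t) C suc s) * ∑[ i < suc t ] (count c (suc s) * countMaxAt d t i)
        ≡⟨ cong (((suc s + t) C suc s) *_) (∑-distribˡ (suc t) (count c (suc s)) (countMaxAt d t)) ⟩
      ((suc s + t) C suc s) * (count c (suc s) * count d (suc t))
        ≡⟨ cong (λ n → (n C suc s) * (count c (suc s) * count d (suc t))) (sym (+-suc s t)) ⟩
      ((s + suc t) C suc s) * (count c (suc s) * count d (suc t)) ∎

  count-glue-≤ : ∀ {s n} c d → s ≤ n → count (glue c s d) n ≡ (n C s) * (count c s * count d (n ∸ s))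
  count-glue-≤ {s} c d s≤n with m≤n⇒∃[o]m+o≡n s≤n
  ... | t , refl = subst (λ u → count (glue c s d) (s + t) ≡ ((s + t) C s) * (count c s * count d u))
                         (sym (m+n∸m≡n s t)) (count-glue s t c d)

module Counting where

  open import Data.Nat using (ℕ; zero; suc; _+_; _<_; _<?_; _≟_)
  open import Data.Nat.Properties using (+-suc; +-*-commutativeSemiring; m<n⇒m<1+n; n<1+n; <-irrefl; ≤-pred; m≤n⇒m<n∨m≡n)
  open import Data.List using (List; []; _∷_; length; filter; map)
  import Data.List.Properties as Listₚ
  open import Data.List.Membership.Propositional using (_∈_)
  import Data.List.Membership.Propositional.Properties as ∈ₚ
  open import Data.List.Membership.Propositional.Properties.WithK using (unique∧set⇒bag)
  open import Data.List.Relation.Binary.BagAndSetEquality using (∼bag⇒↭)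
  open import Data.List.Relation.Binary.Permutation.Propositional.Properties using (↭-length)
  open import Data.List.Relation.Unary.Unique.Propositional using (Unique; []; _∷_)
  import Data.List.Relation.Unary.Unique.Propositional.Properties as Uniqueₚ
  open import Data.List.Relation.Unary.All as All using (All; []; _∷_)
  import Data.List.Relation.Unary.All.Properties as Allₚ
  open import Data.Product using (_×_; _,_; proj₁; proj₂)
  import Data.Sum
  open import Data.Sum using (_⊎_; [_,_])
  open import Data.Empty using (⊥; ⊥-elim)
  open import Function using (_∘_)
  open import Function.Bundles using (mk⇔)
  open import Relation.Nullary using (yes; no; ¬_)
  open import Relation.Nullary.Decidable using (_×-dec_)
  open import Relation.Unary using (Pred; Decidable; _≐_)
  open import Relation.Binary.PropositionalEquality hiding ([_])
  open RangeSum +-*-commutativeSemiring using (∑)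

  private
    variable
      A B : Set

  #[_]_ : ∀ {p} {P : Pred A p} → Decidable P → List A → ℕ
  #[ P? ] xs = length (filter P? xs)

  module _ {p q r} {P : Pred A p} {Q : Pred A q} {R : Pred A r} (P? : Decidable P) (Q? : Decidable Q) (R? : Decidable R) where

    #-split : (∀ {x} → P x → Q x ⊎ R x) → (∀ {x} → Q x → P x) → (∀ {x} → R x → P x) →
              (∀ {x} → Q x → R x → ⊥) → ∀ xs → #[ P? ] xs ≡ #[ Q? ] xs + #[ R? ] xs
    #-split split Q⇒P R⇒P disjoint []       = refl
    #-split split Q⇒P R⇒P disjoint (x ∷ xs) with Q? x | R? x
    ... | yes q | yes r = ⊥-elim (disjoint q r)
    ... | yes q | no ¬r = trans (cong length (Listₚ.filter-accept P? (Q⇒P q)))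
                                (cong suc (#-split split Q⇒P R⇒P disjoint xs))
    ... | no ¬q | yes r = trans (cong length (Listₚ.filter-accept P? (R⇒P r)))
                                (trans (cong suc (#-split split Q⇒P R⇒P disjoint xs)) (sym (+-suc _ _)))
    ... | no ¬q | no ¬r = trans (cong length (Listₚ.filter-reject P? ([ ¬q , ¬r ] ∘ split)))
                                (#-split split Q⇒P R⇒P disjoint xs)

  module _ {p q} {P : Pred A p} {Q : Pred A q} (P? : Decidable P) (Q? : Decidable Q) where

    #-cong : (∀ {x} → P x → Q x) → (∀ {x} → Q x → P x) → ∀ xs → #[ P? ] xs ≡ #[ Q? ] xs
    #-cong P⇒Q Q⇒P xs = cong length (Listₚ.filter-≐ P? Q? (P⇒Q , Q⇒P) xs)

  #-none : ∀ {p} {P : Pred A p} (P? : Decidable P) → (∀ {x} → ¬ P x) → ∀ xs → #[ P? ] xs ≡ 0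
  #-none P? ¬P xs = cong length (Listₚ.filter-none P? (All.universal (λ _ → ¬P) xs))

  module _ {p} {P : Pred A p} (P? : Decidable P) (h : A → ℕ) where

    #-fibres : ∀ K → (∀ {x} → P x → h x < K) → ∀ xs → #[ P? ] xs ≡ ∑[ j < K ] #[ (λ x → P? x ×-dec h x ≟ j) ] xs
    #-fibres K h<K xs = trans (#-cong P? (λ x → P? x ×-dec h x <? K) (λ Px → Px , h<K Px) proj₁ xs) (below K)
      where
      below : ∀ K → #[ (λ x → P? x ×-dec h x <? K) ] xs ≡ ∑[ j < K ] #[ (λ x → P? x ×-dec h x ≟ j) ] xs
      below zero    = #-none _ (λ { (_ , ()) }) xs
      below (suc K) = trans
        (#-split (λ x → P? x ×-dec h x <? suc K) (λ x → P? x ×-dec h x <? K) (λ x → P? x ×-dec h x ≟ K)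
           (λ { (Px , hx<1+K) → Data.Sum.map (Px ,_) (Px ,_) (m≤n⇒m<n∨m≡n (≤-pred hx<1+K)) })
           (λ { (Px , hx<K) → Px , m<n⇒m<1+n hx<K })
           (λ { (Px , refl) → Px , n<1+n (h _) })
           (λ { (_ , hx<K) (_ , refl) → <-irrefl refl hx<K })
           xs)
        (cong (_+ #[ (λ x → P? x ×-dec h x ≟ K) ] xs) (below K))

  Enumeration : List A → Set
  Enumeration xs = Unique xs × (∀ a → a ∈ xs)

  -- Duplicate-free lists with the same members are permutations of each other.
  #-bijection : ∀ {p q} {P : Pred A p} {Q : Pred B q} (P? : Decidable P) (Q? : Decidable Q) {xs ys} →
    Enumeration xs → Enumeration ys → (f : A → B) (g : B → A) →
    (∀ {a} → P a → Q (f a)) → (∀ {b} → Q b → P (g b)) →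
    (∀ {a} → P a → g (f a) ≡ a) → (∀ {b} → Q b → f (g b) ≡ b) →
    #[ P? ] xs ≡ #[ Q? ] ys
  #-bijection {P = P} P? Q? {xs} {ys} (xs-unique , xs-complete) (ys-unique , ys-complete) f g P⇒Qf Q⇒Pg gf≡id fg≡id =
    trans (sym (Listₚ.length-map f Pxs)) (↭-length (∼bag⇒↭ (unique∧set⇒bag fPxs-unique Qys-unique (mk⇔ to from))))
    where
    Pxs = filter P? xs
    Qys-unique : Unique (filter Q? ys)
    Qys-unique = Uniqueₚ.filter⁺ Q? ys-unique

    fPxs-unique : Unique (map f Pxs)
    fPxs-unique = unique-map (Allₚ.all-filter P? xs) (Uniqueₚ.filter⁺ P? xs-unique)
      where
      unique-map : ∀ {zs} → All P zs → Unique zs → Unique (map f zs)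
      unique-map         []         []           = []
      unique-map {z ∷ _} (Pz ∷ Pzs) (z∉zs ∷ uzs) = Allₚ.map⁺ (All.zipWith distinct (Pzs , z∉zs)) ∷ unique-map Pzs uzs
        where
        distinct : ∀ {y} → P y × z ≢ y → f z ≢ f y
        distinct (Py , z≢y) fz≡fy = z≢y (trans (sym (gf≡id Pz)) (trans (cong g fz≡fy) (gf≡id Py)))

    to : ∀ {b} → b ∈ map f Pxs → b ∈ filter Q? ys
    to b∈ with ∈ₚ.∈-map⁻ f b∈
    ... | a , a∈ , refl = ∈ₚ.∈-filter⁺ Q? (ys-complete (f a)) (P⇒Qf (proj₂ (∈ₚ.∈-filter⁻ P? {xs = xs} a∈)))

    from : ∀ {b} → b ∈ filter Q? ys → b ∈ map f Pxs
    from {b} b∈ with proj₂ (∈ₚ.∈-filter⁻ Q? {xs = ys} b∈)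
    ... | Qb = subst (_∈ map f Pxs) (fg≡id Qb) (∈ₚ.∈-map⁺ f (∈ₚ.∈-filter⁺ P? (xs-complete (g b)) (Q⇒Pg Qb)))

module Words where

  open import Data.Nat as ℕ using (ℕ; zero; suc; z≤n; s≤s)
  import Data.Nat.Properties as ℕₚ
  open import Data.Fin as Fin using (Fin; zero; suc; toℕ; _<_; _<?_; _≟_)
  import Data.Fin.Properties as Finₚ
  open import Data.Vec using (Vec; []; _∷_; map)
  import Data.Vec.Properties as Vecₚ
  open import Data.Vec.Relation.Unary.All as All using (All; []; _∷_)
  open import Data.Vec.Relation.Unary.AllPairs using (allPairs?)
  open import Data.Vec.Relation.Unary.Unique.Propositional using (Unique; []; _∷_)
  open import Data.List as List using (List; []; _∷_)
  open import Data.List.Membership.Propositional using (_∈_)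
  import Data.List.Membership.Propositional.Properties as ∈ₚ
  open import Data.List.Relation.Unary.Any using (here)
  import Data.List.Relation.Unary.All as Allᴸ
  open import Data.List.Relation.Unary.Unique.Propositional using ([]; _∷_) renaming (Unique to Uniqueᴸ)
  import Data.List.Relation.Unary.Unique.Propositional.Properties as Uniqueᴸₚ
  open import Data.Product using (_×_; _,_; proj₂)
  open import Data.Empty using (⊥-elim)
  open import Data.Unit using (⊤; tt)
  open import Function using (_∘_)
  open import Relation.Nullary using (Dec; yes; no; ¬_)
  open import Relation.Nullary.Decidable using (_×-dec_; ¬?)
  open import Relation.Binary.PropositionalEquality
  open import Defs using (allWords)
  open Patterns
  open Counting

  private
    variable
      n m k : ℕ

  Relates : Constraint → Fin n → Fin n → Set
  Relates up   a b = a < b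
  Relates down a b = b < a
  Relates free a b = ⊤

  relates? : ∀ x (a b : Fin n) → Dec (Relates x a b)
  relates? up   a b = a <? b
  relates? down a b = b <? a
  relates? free a b = yes tt

  Obeys : Pattern → Vec (Fin n) k → Set
  Obeys c []           = ⊤
  Obeys c (x ∷ [])     = ⊤
  Obeys c (x ∷ y ∷ ys) = Relates (c 0) x y × Obeys (tailᵖ c) (y ∷ ys)

  obeys? : ∀ c (w : Vec (Fin n) k) → Dec (Obeys c w)
  obeys? c []           = yes tt
  obeys? c (x ∷ [])     = yes tt
  obeys? c (x ∷ y ∷ ys) = relates? (c 0) x y ×-dec obeys? (tailᵖ c) (y ∷ ys)

  Admissible : Pattern → Vec (Fin n) k → Set
  Admissible c w = Unique w × Obeys c w

  admissible? : ∀ c (w : Vec (Fin n) k) → Dec (Admissible c w)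
  admissible? c w = allPairs? (λ x y → ¬? (x ≟ y)) w ×-dec obeys? c w

  -- Positions are natural numbers, as for patterns; out-of-range positions act at the end.

  insertAt : ∀ {A : Set} → ℕ → A → Vec A k → Vec A (suc k)
  insertAt zero    v xs       = v ∷ xs
  insertAt (suc j) v []       = v ∷ []
  insertAt (suc j) v (x ∷ xs) = x ∷ insertAt j v xs

  removeAt : ∀ {A : Set} → ℕ → Vec A (suc k) → Vec A k
  removeAt zero    (x ∷ xs)     = xs
  removeAt (suc j) (x ∷ [])     = []
  removeAt (suc j) (x ∷ y ∷ xs) = x ∷ removeAt j (y ∷ xs)

  -- The first index of v in w; the length of w if v does not occur.
  position : Fin n → Vec (Fin n) k → ℕ
  position v []       = 0
  position v (x ∷ xs) with x ≟ v
  ... | yes _ = 0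
  ... | no  _ = suc (position v xs)

  removeAt-insertAt : ∀ {A : Set} j (v : A) (xs : Vec A k) → removeAt j (insertAt j v xs) ≡ xs
  removeAt-insertAt zero          v xs           = refl
  removeAt-insertAt (suc j)       v []           = refl
  removeAt-insertAt (suc zero)    v (x ∷ xs)     = refl
  removeAt-insertAt (suc (suc j)) v (x ∷ [])     = refl
  removeAt-insertAt (suc (suc j)) v (x ∷ y ∷ xs) = cong (x ∷_) (removeAt-insertAt (suc j) v (y ∷ xs))

  position-< : ∀ (v : Fin n) (w : Vec (Fin n) k) → ¬ All (v ≢_) w → position v w ℕ.< k
  position-< v []       v∉w = ⊥-elim (v∉w [])
  position-< v (x ∷ xs) v∉w with x ≟ v
  ... | yes _   = s≤s z≤n
  ... | no  x≢v = s≤s (position-< v xs λ v∉xs → v∉w (≢-sym x≢v ∷ v∉xs))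

  insertAt-removeAt-position : ∀ (v : Fin n) (w : Vec (Fin n) (suc k)) → ¬ All (v ≢_) w →
                               insertAt (position v w) v (removeAt (position v w) w) ≡ w
  insertAt-removeAt-position v (x ∷ xs) v∈w with x ≟ v
  ... | yes refl = refl
  insertAt-removeAt-position v (x ∷ [])     v∈w | no x≢v = ⊥-elim (v∈w (≢-sym x≢v ∷ []))
  insertAt-removeAt-position v (x ∷ y ∷ xs) v∈w | no x≢v =
    cong (x ∷_) (insertAt-removeAt-position v (y ∷ xs) λ v∉ys → v∈w (≢-sym x≢v ∷ v∉ys))

  position-insertAt : ∀ j (v : Fin n) (xs : Vec (Fin n) k) → j ℕ.≤ k → All (v ≢_) xs →
                      position v (insertAt j v xs) ≡ j
  position-insertAt zero    v xs       _         _ with v ≟ v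
  ... | yes _   = refl
  ... | no  v≢v = ⊥-elim (v≢v refl)
  position-insertAt (suc j) v (x ∷ xs) (s≤s j≤k) (v≢x ∷ v∉xs) with x ≟ v
  ... | yes x≡v = ⊥-elim (≢-sym v≢x x≡v)
  ... | no  _   = cong suc (position-insertAt j v xs j≤k v∉xs)

  module _ {A : Set} {P : A → Set} where

    All-insertAt⁺ : ∀ j {v} {xs : Vec A k} → P v → All P xs → All P (insertAt j v xs)
    All-insertAt⁺ zero    pv pxs        = pv ∷ pxs
    All-insertAt⁺ (suc j) pv []         = pv ∷ []
    All-insertAt⁺ (suc j) pv (px ∷ pxs) = px ∷ All-insertAt⁺ j pv pxs

    All-insertAt⁻ : ∀ j {v} (xs : Vec A k) → All P (insertAt j v xs) → P v × All P xs
    All-insertAt⁻ zero    xs       (pv ∷ pxs) = pv , pxs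
    All-insertAt⁻ (suc j) []       (pv ∷ [])  = pv , []
    All-insertAt⁻ (suc j) (x ∷ xs) (px ∷ p)   with All-insertAt⁻ j xs p
    ... | pv , pxs = pv , px ∷ pxs

  Unique-insertAt⁺ : ∀ j {v : Fin n} {xs : Vec (Fin n) k} → All (v ≢_) xs → Unique xs → Unique (insertAt j v xs)
  Unique-insertAt⁺ zero    v∉xs u                = v∉xs ∷ u
  Unique-insertAt⁺ (suc j) []   []               = [] ∷ []
  Unique-insertAt⁺ (suc j) (v≢x ∷ v∉xs) (x∉xs ∷ u) =
    All-insertAt⁺ j (≢-sym v≢x) x∉xs ∷ Unique-insertAt⁺ j v∉xs u

  Unique-insertAt⁻ : ∀ j {v : Fin n} (xs : Vec (Fin n) k) → Unique (insertAt j v xs) → All (v ≢_) xs × Unique xs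
  Unique-insertAt⁻ zero    xs       (v∉xs ∷ u) = v∉xs , u
  Unique-insertAt⁻ (suc j) []       _          = [] , []
  Unique-insertAt⁻ (suc j) (x ∷ xs) (x∉ ∷ u)   with All-insertAt⁻ j xs x∉ | Unique-insertAt⁻ j xs u
  ... | x≢v , x∉xs | v∉xs , uxs = ≢-sym x≢v ∷ v∉xs , x∉xs ∷ uxs

  relates-toMax⁺ : ∀ c {x v : Fin n} → x < v → ascentOK c ≡ 1 → Relates c x v
  relates-toMax⁺ up   x<v _ = x<v
  relates-toMax⁺ free x<v _ = tt

  relates-toMax⁻ : ∀ c {x v : Fin n} → x < v → Relates c x v → ascentOK c ≡ 1
  relates-toMax⁻ up   x<v _   = refl
  relates-toMax⁻ down x<v v<x = ⊥-elim (ℕₚ.<-asym x<v v<x)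
  relates-toMax⁻ free x<v _   = refl

  relates-fromMax⁺ : ∀ c {y v : Fin n} → y < v → descentOK c ≡ 1 → Relates c v y
  relates-fromMax⁺ down y<v _ = y<v
  relates-fromMax⁺ free y<v _ = tt

  relates-fromMax⁻ : ∀ c {y v : Fin n} → y < v → Relates c v y → descentOK c ≡ 1
  relates-fromMax⁻ up   y<v v<y = ⊥-elim (ℕₚ.<-asym y<v v<y)
  relates-fromMax⁻ down y<v _   = refl
  relates-fromMax⁻ free y<v _   = refl

  MaxFits : Pattern → ℕ → ℕ → Set
  MaxFits c k j = maxFitsLeft c j ≡ 1 × maxFitsRight c k j ≡ 1

  Obeys-insertMax⁺ : ∀ c j {v : Fin n} (xs : Vec (Fin n) k) → All (_< v) xs → j ℕ.≤ k →
                     MaxFits c k j → Obeys (removeᵖ c j) xs → Obeys c (insertAt j v xs)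
  Obeys-insertMax⁺ c zero          []           _                 _         _          _ = tt
  Obeys-insertMax⁺ c zero          (y ∷ ys)     (y<v ∷ _)         _         (_ , fR)   o = relates-fromMax⁺ (c 0) y<v fR , o
  Obeys-insertMax⁺ c (suc zero)    (x ∷ [])     (x<v ∷ _)         _         (fL , _)   _ = relates-toMax⁺ (c 0) x<v fL , tt
  Obeys-insertMax⁺ c (suc zero)    (x ∷ y ∷ ys) (x<v ∷ y<v ∷ _)   _         (fL , fR)  (_ , o) =
    relates-toMax⁺ (c 0) x<v fL , relates-fromMax⁺ (c 1) y<v fR , o
  Obeys-insertMax⁺ c (suc (suc j)) (x ∷ y ∷ ys) (_ ∷ ys<v)        (s≤s j≤k) fits       (r , o) =
    r , Obeys-insertMax⁺ (tailᵖ c) (suc j) (y ∷ ys) ys<v j≤k fits o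

  Obeys-insertMax⁻ : ∀ c j {v : Fin n} (xs : Vec (Fin n) k) → All (_< v) xs → j ℕ.≤ k → Obeys c (insertAt j v xs) →
                     MaxFits c k j × Obeys (removeᵖ c j) xs
  Obeys-insertMax⁻ c zero          []           _               _         _       = (refl , refl) , tt
  Obeys-insertMax⁻ c zero          (y ∷ ys)     (y<v ∷ _)       _         (r , o) = (refl , relates-fromMax⁻ (c 0) y<v r) , o
  Obeys-insertMax⁻ c (suc zero)    (x ∷ [])     (x<v ∷ _)       _         (r , _) = (relates-toMax⁻ (c 0) x<v r , refl) , tt
  Obeys-insertMax⁻ c (suc zero)    (x ∷ y ∷ ys) (x<v ∷ y<v ∷ _) _         (r , r′ , o) =
    (relates-toMax⁻ (c 0) x<v r , relates-fromMax⁻ (c 1) y<v r′) , tt , o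
  Obeys-insertMax⁻ c (suc (suc j)) (x ∷ y ∷ ys) (_ ∷ ys<v)      (s≤s j≤k) (r , o)
    with Obeys-insertMax⁻ (tailᵖ c) (suc j) (y ∷ ys) ys<v j≤k o
  ... | fits , o′ = fits , r , o′

  Admissible-insertMax⁺ : ∀ c j {v : Fin n} (xs : Vec (Fin n) k) → All (_< v) xs → j ℕ.≤ k →
                          MaxFits c k j → Admissible (removeᵖ c j) xs → Admissible c (insertAt j v xs)
  Admissible-insertMax⁺ c j xs xs<v j≤k fits (u , o) =
    Unique-insertAt⁺ j (All.map (≢-sym ∘ Finₚ.<⇒≢) xs<v) u , Obeys-insertMax⁺ c j xs xs<v j≤k fits o

  Admissible-insertMax⁻ : ∀ c j {v : Fin n} (xs : Vec (Fin n) k) → All (_< v) xs → j ℕ.≤ k →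
                          Admissible c (insertAt j v xs) → MaxFits c k j × Admissible (removeᵖ c j) xs
  Admissible-insertMax⁻ c j xs xs<v j≤k (u , o) with Obeys-insertMax⁻ c j xs xs<v j≤k o
  ... | fits , oxs = fits , proj₂ (Unique-insertAt⁻ j xs u) , oxs

  module _ (φ : Fin n → Fin m) where

    PreservesToℕ : Vec (Fin n) k → Set
    PreservesToℕ = All (λ x → toℕ (φ x) ≡ toℕ x)

    relates-map : ∀ c {a b} → toℕ (φ a) ≡ toℕ a → toℕ (φ b) ≡ toℕ b → Relates c a b → Relates c (φ a) (φ b)
    relates-map up   φa≡a φb≡b a<b = subst₂ ℕ._<_ (sym φa≡a) (sym φb≡b) a<b
    relates-map down φa≡a φb≡b b<a = subst₂ ℕ._<_ (sym φb≡b) (sym φa≡a) b<a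
    relates-map free φa≡a φb≡b _   = tt

    Obeys-map⁺ : ∀ c (w : Vec (Fin n) k) → PreservesToℕ w → Obeys c w → Obeys c (map φ w)
    Obeys-map⁺ c []           _                  _       = tt
    Obeys-map⁺ c (x ∷ [])     _                  _       = tt
    Obeys-map⁺ c (x ∷ y ∷ ys) (φx≡x ∷ φy≡y ∷ pw) (r , o) =
      relates-map (c 0) φx≡x φy≡y r , Obeys-map⁺ (tailᵖ c) (y ∷ ys) (φy≡y ∷ pw) o

    Unique-map⁺ : ∀ (w : Vec (Fin n) k) → PreservesToℕ w → Unique w → Unique (map φ w)
    Unique-map⁺ []       _            _          = []
    Unique-map⁺ (x ∷ xs) (φx≡x ∷ pxs) (x∉xs ∷ u) = distinct xs pxs x∉xs ∷ Unique-map⁺ xs pxs u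
      where
      distinct : ∀ {k} (ys : Vec (Fin n) k) → PreservesToℕ ys → All (x ≢_) ys → All (φ x ≢_) (map φ ys)
      distinct []       _            _            = []
      distinct (y ∷ ys) (φy≡y ∷ pys) (x≢y ∷ x∉ys) =
        (λ φx≡φy → x≢y (Finₚ.toℕ-injective (trans (sym φx≡x) (trans (cong toℕ φx≡φy) φy≡y))))
        ∷ distinct ys pys x∉ys

  map-id-on : ∀ {A : Set} {f : A → A} {xs : Vec A k} → All (λ x → f x ≡ x) xs → map f xs ≡ xs
  map-id-on []           = refl
  map-id-on (fx≡x ∷ fxs) = cong₂ _∷_ fx≡x (map-id-on fxs)

  toℕ-pinch : ∀ (i : Fin n) (j : Fin (suc n)) → toℕ j ℕ.≤ toℕ i → toℕ (Fin.pinch i j) ≡ toℕ j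
  toℕ-pinch {suc n} i       zero    _         = refl
  toℕ-pinch {suc n} (suc i) (suc j) (s≤s j≤i) = cong suc (toℕ-pinch i j j≤i)

  allWords-enumeration : ∀ n k → Enumeration (allWords n k)
  allWords-enumeration n k = unique k , complete k
    where
    concatMap≡cartesianProduct : ∀ {A : Set} {k} (xs : List A) (L : List (Vec A k)) →
      List.concatMap (λ x → List.map (x ∷_) L) xs ≡ List.cartesianProductWith _∷_ xs L
    concatMap≡cartesianProduct []       L = refl
    concatMap≡cartesianProduct (x ∷ xs) L = cong (List.map (x ∷_) L List.++_) (concatMap≡cartesianProduct xs L)

    unique : ∀ k → Uniqueᴸ (allWords n k)
    unique zero    = Allᴸ.[] ∷ []
    unique (suc k) rewrite concatMap≡cartesianProduct (List.allFin n) (allWords n k) =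
      Uniqueᴸₚ.cartesianProductWith⁺ _∷_ Vecₚ.∷-injective (Uniqueᴸₚ.allFin⁺ n) (unique k)

    complete : ∀ k (w : Vec (Fin n) k) → w ∈ allWords n k
    complete zero    []      = here refl
    complete (suc k) (x ∷ w) rewrite concatMap≡cartesianProduct (List.allFin n) (allWords n k) =
      ∈ₚ.∈-cartesianProductWith⁺ _∷_ (∈ₚ.∈-allFin x) (complete k w)

  card : Pattern → ℕ → ℕ
  card c n = #[ admissible? c ] (allWords n n)

module MaximumRemoval where

  open import Data.Nat as ℕ using (ℕ; zero; suc) renaming (_≟_ to _≟ℕ_)
  import Data.Nat.Properties as ℕₚ
  open import Data.Fin as Fin using (Fin; toℕ; _<_)
  import Data.Fin.Properties as Finₚ
  open import Data.Vec as Vec using (Vec; map)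
  import Data.Vec.Properties as Vecₚ
  open import Data.Vec.Relation.Unary.All as All using (All)
  import Data.Vec.Relation.Unary.All.Properties as Allₚ
  open import Data.Vec.Relation.Unary.Unique.Propositional using (Unique)
  open import Data.Vec.Relation.Unary.Unique.Propositional.Properties using (lookup-injective)
  open import Data.Product using (_×_; _,_; proj₁; proj₂)
  open import Data.Sum using (inj₁; inj₂)
  open import Function using (_∘_; id)
  open import Relation.Nullary using (Dec; ¬_)
  open import Relation.Nullary.Decidable using (_×-dec_)
  open import Relation.Binary.PropositionalEquality
  open import Defs using (allWords)
  open RangeSum ℕₚ.+-*-commutativeSemiring using (∑; ∑-cong)
  open Patterns
  open Counting
  open Words

  module OfLength (m : ℕ) where

    M : ℕ
    M = suc m

    top : Fin (suc M)
    top = Fin.fromℕ M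

    lower : Fin (suc M) → Fin M
    lower = Fin.pinch (Fin.fromℕ m)

    raise : Fin M → Fin (suc M)
    raise = Fin.inject₁

    <top : ∀ {x} → top ≢ x → x < top
    <top top≢x = Finₚ.≤∧≢⇒< (Finₚ.≤fromℕ _) (≢-sym top≢x)

    toℕ-lower : ∀ {x} → x < top → toℕ (lower x) ≡ toℕ x
    toℕ-lower x<top = toℕ-pinch (Fin.fromℕ m) _ (ℕₚ.≤-pred x<top)

    raise<top : ∀ y → raise y < top
    raise<top y = subst (toℕ (raise y) ℕ.<_) (sym (Finₚ.toℕ-fromℕ M)) (Finₚ.inject₁ℕ< y)

    lower-raise : ∀ y → lower (raise y) ≡ y
    lower-raise y = Finₚ.toℕ-injective (trans (toℕ-lower (raise<top y)) (Finₚ.toℕ-inject₁ y))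

    raise-lower : ∀ {x} → x < top → raise (lower x) ≡ x
    raise-lower x<top = Finₚ.toℕ-injective (trans (Finₚ.toℕ-inject₁ _) (toℕ-lower x<top))

    top-occurs : ∀ (w : Vec (Fin (suc M)) (suc M)) → Unique w → ¬ All (top ≢_) w
    top-occurs w uw top∉w with Finₚ.pigeonhole ℕₚ.≤-refl (Vec.lookup (map lower w))
    ... | i , j , i<j , same = ℕₚ.<-irrefl (cong toℕ (lookup-injective uw′ i j same)) i<j
      where
      uw′ : Unique (map lower w)
      uw′ = Unique-map⁺ lower w (All.map (toℕ-lower ∘ <top) top∉w) uw

    module _ (c : Pattern) (j : ℕ) (j≤M : j ℕ.≤ M) where

      TopAt : Vec (Fin (suc M)) (suc M) → Set
      TopAt w = Admissible c w × position top w ≡ j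

      topAt? : ∀ w → Dec (TopAt w)
      topAt? w = admissible? c w ×-dec position top w ≟ℕ j

      removeTop : Vec (Fin (suc M)) (suc M) → Vec (Fin M) M
      removeTop w = map lower (removeAt j w)

      insertTop : Vec (Fin M) M → Vec (Fin (suc M)) (suc M)
      insertTop w′ = insertAt j top (map raise w′)

      insertAt-removeAt-top : ∀ {w} → TopAt w → insertAt j top (removeAt j w) ≡ w
      insertAt-removeAt-top {w} (adm , pos≡j) =
        subst (λ i → insertAt i top (removeAt i w) ≡ w) pos≡j (insertAt-removeAt-position top w (top-occurs w (proj₁ adm)))

      removeAt-<top : ∀ {w} → TopAt w → All (_< top) (removeAt j w)
      removeAt-<top {w} tw = All.map <top (proj₁ (Unique-insertAt⁻ j (removeAt j w) unique))
        where unique = subst Unique (sym (insertAt-removeAt-top tw)) (proj₁ (proj₁ tw))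

      TopAt-decompose : ∀ {w} → TopAt w → MaxFits c M j × Admissible (removeᵖ c j) (removeAt j w)
      TopAt-decompose {w} tw = Admissible-insertMax⁻ c j (removeAt j w) (removeAt-<top tw) j≤M
        (subst (Admissible c) (sym (insertAt-removeAt-top tw)) (proj₁ tw))

      removeTop-admissible : ∀ {w} → TopAt w → Admissible (removeᵖ c j) (removeTop w)
      removeTop-admissible {w} tw with TopAt-decompose tw
      ... | _ , u , o = Unique-map⁺ lower _ pres u , Obeys-map⁺ lower (removeᵖ c j) _ pres o
        where pres = All.map toℕ-lower (removeAt-<top tw)

      insertTop-topAt : MaxFits c M j → ∀ {w′} → Admissible (removeᵖ c j) w′ → TopAt (insertTop w′)
      insertTop-topAt fits {w′} (u , o) =
        Admissible-insertMax⁺ c j xs xs<top j≤M fits (Unique-map⁺ raise w′ pres u , Obeys-map⁺ raise (removeᵖ c j) w′ pres o) ,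
        position-insertAt j top xs j≤M (All.map (≢-sym ∘ Finₚ.<⇒≢) xs<top)
        where
        xs = map raise w′
        pres = All.universal Finₚ.toℕ-inject₁ w′
        xs<top : All (_< top) xs
        xs<top = Allₚ.map⁺ (All.universal raise<top w′)

      insertTop-removeTop : ∀ {w} → TopAt w → insertTop (removeTop w) ≡ w
      insertTop-removeTop {w} tw = begin
        insertAt j top (map raise (map lower (removeAt j w)))
          ≡⟨ cong (insertAt j top) (sym (Vecₚ.map-∘ raise lower _)) ⟩
        insertAt j top (map (raise ∘ lower) (removeAt j w))
          ≡⟨ cong (insertAt j top) (map-id-on (All.map raise-lower (removeAt-<top tw))) ⟩
        insertAt j top (removeAt j w)
          ≡⟨ insertAt-removeAt-top tw ⟩
        w                                                      ∎
        where open ≡-Reasoning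

      removeTop-insertTop : ∀ w′ → removeTop (insertTop w′) ≡ w′
      removeTop-insertTop w′ = begin
        map lower (removeAt j (insertAt j top (map raise w′)))  ≡⟨ cong (map lower) (removeAt-insertAt j top (map raise w′)) ⟩
        map lower (map raise w′)                                ≡⟨ sym (Vecₚ.map-∘ lower raise w′) ⟩
        map (lower ∘ raise) w′                                  ≡⟨ Vecₚ.map-cong lower-raise w′ ⟩
        map id w′                                               ≡⟨ Vecₚ.map-id w′ ⟩
        w′                                                      ∎
        where open ≡-Reasoning

      #-topAt : card (removeᵖ c j) M ≡ count (removeᵖ c j) M → #[ topAt? ] (allWords (suc M) (suc M)) ≡ countMaxAt c M j
      #-topAt card≡ with maxFitsLeft-01 c j | maxFitsRight-01 c M j
      ... | inj₁ left≡0 | _ rewrite left≡0 =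
        #-none topAt? (λ tw → ℕₚ.0≢1+n (trans (sym left≡0) (proj₁ (proj₁ (TopAt-decompose tw))))) (allWords (suc M) (suc M))
      ... | inj₂ _ | inj₁ right≡0 rewrite right≡0 | ℕₚ.*-zeroʳ (maxFitsLeft c j) =
        #-none topAt? (λ tw → ℕₚ.0≢1+n (trans (sym right≡0) (proj₂ (proj₁ (TopAt-decompose tw))))) (allWords (suc M) (suc M))
      ... | inj₂ left≡1 | inj₂ right≡1 rewrite left≡1 | right≡1 | ℕₚ.+-identityʳ (count (removeᵖ c j) M) =
        trans (#-bijection topAt? (admissible? (removeᵖ c j)) (allWords-enumeration _ _) (allWords-enumeration _ _)
                 removeTop insertTop removeTop-admissible (insertTop-topAt (left≡1 , right≡1))
                 insertTop-removeTop (λ {w′} _ → removeTop-insertTop w′))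
              card≡

  card≡count : ∀ n c → card c n ≡ count c n
  card≡count zero          c = refl
  card≡count (suc zero)    c = refl
  card≡count (suc (suc m)) c = begin
    #[ admissible? c ] (allWords (suc M) (suc M))
      ≡⟨ #-fibres (admissible? c) (position top) (suc M) (λ {w} adm → position-< top w (top-occurs w (proj₁ adm)))
                  (allWords (suc M) (suc M)) ⟩
    ∑[ j < suc M ] #[ (λ w → admissible? c w ×-dec position top w ≟ℕ j) ] (allWords (suc M) (suc M))
      ≡⟨ ∑-cong (suc M) (λ j j<1+M → #-topAt c j (ℕₚ.≤-pred j<1+M) (card≡count (suc m) (removeᵖ c j))) ⟩
    count c (suc M) ∎
    where
    open OfLength m
    open ≡-Reasoning

module PatternCounts where

  open import Data.Nat as ℕ using (ℕ; zero; suc; z≤n; s≤s)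
  open import Data.Nat.Combinatorics using (_C_; nC1≡n)
  import Data.Nat.Properties as ℕₚ
  open import Data.Fin as Fin using (Fin; zero; suc; toℕ; _<_)
  import Data.Fin.Properties as Finₚ
  open import Data.Vec as Vec using (Vec; []; _∷_; map)
  import Data.Vec.Properties as Vecₚ
  open import Data.Vec.Relation.Unary.Unique.Propositional using (Unique; []; _∷_)
  import Data.Vec.Relation.Unary.Unique.Propositional.Properties as Uniqueₚ
  open import Data.Vec.Relation.Unary.All using ([]; _∷_)
  open import Data.Product using (_×_; _,_)
  import Data.Sum
  open import Data.Sum using (_⊎_; inj₁; inj₂)
  open import Data.Empty using (⊥-elim)
  open import Data.Unit using (tt)
  open import Function using (_∘_; id)
  open import Relation.Nullary using (¬_)
  open import Relation.Nullary.Decidable using (_×-dec_)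
  open import Relation.Binary.Definitions using (tri<; tri≈; tri>)
  open import Relation.Binary.PropositionalEquality
  open import Defs using (Word; IsPerm; Step; IsAlternating; InA; inA?; Prefix231; prefix231?; allWords; cardA231)
  open Patterns
  open Counting
  open Words
  open MaximumRemoval using (card≡count)

  private
    variable
      n m k : ℕ

  Obeys-cong : ∀ {c c′} → c ≗ c′ → (w : Vec (Fin n) k) → Obeys c w → Obeys c′ w
  Obeys-cong c≗c′ []           _       = tt
  Obeys-cong c≗c′ (x ∷ [])     _       = tt
  Obeys-cong c≗c′ (x ∷ y ∷ ys) (r , o) = subst (λ z → Relates z x y) (c≗c′ 0) r , Obeys-cong (c≗c′ ∘ suc) (y ∷ ys) o

  Obeys-[]≔-free : ∀ c k x (w : Vec (Fin n) m) → Obeys (c [ k ]≔ x) w → Obeys (c [ k ]≔ free) w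
  Obeys-[]≔-free c k       x []           _       = tt
  Obeys-[]≔-free c k       x (a ∷ [])     _       = tt
  Obeys-[]≔-free c zero    x (a ∷ b ∷ w)  (_ , o) = tt , o
  Obeys-[]≔-free c (suc k) x (a ∷ b ∷ w)  (r , o) = r , Obeys-[]≔-free (tailᵖ c) k x (b ∷ w) o

  Obeys-[]≔-free⁻ : ∀ c k (w : Vec (Fin n) m) → suc k ℕ.< m → Unique w → Obeys (c [ k ]≔ free) w →
                    Obeys (c [ k ]≔ up) w ⊎ Obeys (c [ k ]≔ down) w
  Obeys-[]≔-free⁻ c zero    (a ∷ [])    (s≤s ())    _               _
  Obeys-[]≔-free⁻ c zero    (a ∷ b ∷ w) _           ((a≢b ∷ _) ∷ _) (_ , o) with Finₚ.<-cmp a b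
  ... | tri< a<b _ _ = inj₁ (a<b , o)
  ... | tri≈ _ a≡b _ = ⊥-elim (a≢b a≡b)
  ... | tri> _ _ b<a = inj₂ (b<a , o)
  Obeys-[]≔-free⁻ c (suc k) (a ∷ b ∷ w) (s≤s 2+k<m) (_ ∷ u)        (r , o) =
    Data.Sum.map (r ,_) (r ,_) (Obeys-[]≔-free⁻ (tailᵖ c) k (b ∷ w) 2+k<m u o)

  Obeys-[]≔-up-down : ∀ c k (w : Vec (Fin n) m) → suc k ℕ.< m → Obeys (c [ k ]≔ up) w → ¬ Obeys (c [ k ]≔ down) w
  Obeys-[]≔-up-down c zero    (a ∷ [])    (s≤s ())    _         _
  Obeys-[]≔-up-down c zero    (a ∷ b ∷ w) _           (a<b , _) (b<a , _) = ℕₚ.<-asym a<b b<a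
  Obeys-[]≔-up-down c (suc k) (a ∷ b ∷ w) (s≤s 2+k<m) (_ , o)   (_ , o′)  = Obeys-[]≔-up-down (tailᵖ c) k (b ∷ w) 2+k<m o o′

  count-[]≔-free : ∀ c k n → suc k ℕ.< n → count (c [ k ]≔ free) n ≡ count (c [ k ]≔ up) n ℕ.+ count (c [ k ]≔ down) n
  count-[]≔-free c k n 1+k<n = begin
    count (c [ k ]≔ free) n
      ≡⟨ sym (card≡count n _) ⟩
    card (c [ k ]≔ free) n
      ≡⟨ #-split (admissible? _) (admissible? _) (admissible? _)
           (λ {w} (u , o) → Data.Sum.map (u ,_) (u ,_) (Obeys-[]≔-free⁻ c k w 1+k<n u o))
           (λ {w} (u , o) → u , Obeys-[]≔-free c k up w o)
           (λ {w} (u , o) → u , Obeys-[]≔-free c k down w o)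
           (λ {w} (_ , o) (_ , o′) → Obeys-[]≔-up-down c k w 1+k<n o o′)
           (allWords n n) ⟩
    card (c [ k ]≔ up) n ℕ.+ card (c [ k ]≔ down) n
      ≡⟨ cong₂ ℕ._+_ (card≡count n _) (card≡count n _) ⟩
    count (c [ k ]≔ up) n ℕ.+ count (c [ k ]≔ down) n ∎
    where open ≡-Reasoning

  opposite-< : ∀ {a b : Fin n} → a < b → Fin.opposite b < Fin.opposite a
  opposite-< {n} {a} {b} a<b = subst₂ ℕ._<_ (sym (Finₚ.opposite-prop b)) (sym (Finₚ.opposite-prop a))
    (ℕₚ.∸-monoʳ-< (s≤s a<b) (Finₚ.toℕ<n b))

  relates-opposite : ∀ x {a b : Fin n} → Relates x a b → Relates (flip x) (Fin.opposite a) (Fin.opposite b)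
  relates-opposite up   a<b = opposite-< a<b
  relates-opposite down b<a = opposite-< b<a
  relates-opposite free _   = tt

  Obeys-opposite : ∀ c (w : Vec (Fin n) k) → Obeys c w → Obeys (flip ∘ c) (map Fin.opposite w)
  Obeys-opposite c []           _       = tt
  Obeys-opposite c (x ∷ [])     _       = tt
  Obeys-opposite c (x ∷ y ∷ ys) (r , o) = relates-opposite (c 0) r , Obeys-opposite (tailᵖ c) (y ∷ ys) o

  card-flip : ∀ c n → card c n ≡ card (flip ∘ c) n
  card-flip c n = #-bijection (admissible? c) (admissible? (flip ∘ c)) (allWords-enumeration n n) (allWords-enumeration n n)
    (map Fin.opposite) (map Fin.opposite)
    (λ {w} (u , o) → unique-opposite u , Obeys-opposite c w o)
    (λ {w} (u , o) → unique-opposite u , Obeys-cong (flip-involutive ∘ c) (map Fin.opposite w) (Obeys-opposite (flip ∘ c) w o))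
    (λ {w} _ → opposite-opposite w) (λ {w} _ → opposite-opposite w)
    where
    unique-opposite : ∀ {w : Vec (Fin n) n} → Unique w → Unique (map Fin.opposite w)
    unique-opposite = Uniqueₚ.map⁺ λ {a} {b} eq →
      trans (sym (Finₚ.opposite-involutive a)) (trans (cong Fin.opposite eq) (Finₚ.opposite-involutive b))
    opposite-opposite : ∀ (w : Vec (Fin n) n) → map Fin.opposite (map Fin.opposite w) ≡ w
    opposite-opposite w = trans (sym (Vecₚ.map-∘ Fin.opposite Fin.opposite w))
                                (trans (Vecₚ.map-cong Finₚ.opposite-involutive w) (Vecₚ.map-id w))

  count-upDown≡count-downUp : ∀ n → count upDown n ≡ count downUp n
  count-upDown≡count-downUp n = begin
    count upDown n          ≡⟨ sym (card≡count n upDown) ⟩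
    card upDown n           ≡⟨ card-flip upDown n ⟩
    card (flip ∘ upDown) n  ≡⟨ card≡count n (flip ∘ upDown) ⟩
    count (flip ∘ upDown) n ≡⟨ count-cong n flip-upDown ⟩
    count downUp n          ∎
    where open ≡-Reasoning

  IsPerm⇒Unique : ∀ (σ : Word n) → IsPerm σ → Unique σ
  IsPerm⇒Unique σ inj = subst Unique (Vecₚ.tabulate∘lookup σ) (Uniqueₚ.tabulate⁺ (inj _ _))

  Obeys⇒links : ∀ c (w : Vec (Fin n) k) → Obeys c w →
                ∀ i j → toℕ j ≡ suc (toℕ i) → Relates (c (toℕ i)) (Vec.lookup w i) (Vec.lookup w j)
  Obeys⇒links c (x ∷ y ∷ ys) (r , o) zero    (suc zero)    _ = r
  Obeys⇒links c (x ∷ y ∷ ys) (r , o) (suc i) (suc j)       e = Obeys⇒links (tailᵖ c) (y ∷ ys) o i j (ℕₚ.suc-injective e)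

  links⇒Obeys : ∀ c (w : Vec (Fin n) k) →
                (∀ i j → toℕ j ≡ suc (toℕ i) → Relates (c (toℕ i)) (Vec.lookup w i) (Vec.lookup w j)) → Obeys c w
  links⇒Obeys c []           _     = tt
  links⇒Obeys c (x ∷ [])     _     = tt
  links⇒Obeys c (x ∷ y ∷ ys) links =
    links zero (suc zero) refl , links⇒Obeys (tailᵖ c) (y ∷ ys) λ i j e → links (suc i) (suc j) (cong suc e)

  Step≡Relates-upDown : ∀ k (a b : Fin n) → Step k a b ≡ Relates (upDown k) a b
  Step≡Relates-upDown zero          a b = refl
  Step≡Relates-upDown (suc zero)    a b = refl
  Step≡Relates-upDown (suc (suc k)) a b = Step≡Relates-upDown k a b

  IsAlternating⇒Obeys : ∀ (σ : Word n) → IsAlternating σ → Obeys upDown σ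
  IsAlternating⇒Obeys σ alt = links⇒Obeys upDown σ λ i j e → subst id (Step≡Relates-upDown (toℕ i) _ _) (alt i j e)

  Obeys⇒IsAlternating : ∀ (σ : Word n) → Obeys upDown σ → IsAlternating σ
  Obeys⇒IsAlternating σ o i j e = subst id (sym (Step≡Relates-upDown (toℕ i) _ _)) (Obeys⇒links upDown σ o i j e)

  swap₀₁ : ∀ {A : Set} → Vec A (suc (suc k)) → Vec A (suc (suc k))
  swap₀₁ (a ∷ b ∷ w) = b ∷ a ∷ w

  swap₀₁-involutive : ∀ {A : Set} (w : Vec A (suc (suc k))) → swap₀₁ (swap₀₁ w) ≡ w
  swap₀₁-involutive (a ∷ b ∷ w) = refl

  Unique-swap₀₁ : ∀ (w : Vec (Fin n) (suc (suc k))) → Unique w → Unique (swap₀₁ w)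
  Unique-swap₀₁ (a ∷ b ∷ w) ((a≢b ∷ a∉w) ∷ b∉w ∷ uw) = (≢-sym a≢b ∷ b∉w) ∷ a∉w ∷ uw

  -- For alternating σ, σ₃ < σ₁ < σ₂ says that σ₂ σ₁ σ₃ σ₄ … descends twice and then
  -- alternates, and conversely σ₃ < σ₂ is recovered by transitivity.
  cardA231≡card : ∀ m → cardA231 m ≡ card (down ∷ᵖ downUp) (3 ℕ.+ m)
  cardA231≡card m = #-bijection (λ σ → inA? σ ×-dec prefix231? σ) (admissible? (down ∷ᵖ downUp))
    (allWords-enumeration (3 ℕ.+ m) (3 ℕ.+ m)) (allWords-enumeration (3 ℕ.+ m) (3 ℕ.+ m)) swap₀₁ swap₀₁ to from
    (λ {σ} _ → swap₀₁-involutive σ) (λ {w} _ → swap₀₁-involutive w)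
    where
    to : ∀ {σ} → InA σ × Prefix231 σ → Admissible (down ∷ᵖ downUp) (swap₀₁ σ)
    to {σ@(a ∷ b ∷ c ∷ _)} ((perm , alt) , c<a , a<b) with IsAlternating⇒Obeys σ alt
    ... | _ , _ , o = Unique-swap₀₁ σ (IsPerm⇒Unique σ perm) , a<b , c<a , o
    from : ∀ {w} → Admissible (down ∷ᵖ downUp) w → InA (swap₀₁ w) × Prefix231 (swap₀₁ w)
    from {w@(b ∷ a ∷ c ∷ _)} (u , a<b , c<a , o) =
      (Uniqueₚ.lookup-injective (Unique-swap₀₁ w u) , Obeys⇒IsAlternating (swap₀₁ w) (a<b , ℕₚ.<-trans c<a a<b , o)) ,
      c<a , a<b

  cardA231-recurrence : ∀ m → cardA231 m ℕ.+ count downUp (3 ℕ.+ m) ≡ (3 ℕ.+ m) ℕ.* count downUp (2 ℕ.+ m)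
  cardA231-recurrence m = begin
    cardA231 m ℕ.+ count downUp N
      ≡⟨ cong₂ ℕ._+_ (trans (cardA231≡card m) (card≡count N (down ∷ᵖ downUp))) (sym (count-upDown≡count-downUp N)) ⟩
    count (down ∷ᵖ downUp) N ℕ.+ count upDown N
      ≡⟨ ℕₚ.+-comm (count (down ∷ᵖ downUp) N) (count upDown N) ⟩
    count upDown N ℕ.+ count (down ∷ᵖ downUp) N
      ≡⟨ cong (ℕ._+ count (down ∷ᵖ downUp) N) (count-cong N upDown≗up∷downUp) ⟩
    count (up ∷ᵖ downUp) N ℕ.+ count (down ∷ᵖ downUp) N
      ≡⟨ sym (count-[]≔-free (free ∷ᵖ downUp) 0 N (s≤s (s≤s z≤n))) ⟩
    count (glue decreasing 1 downUp) (1 ℕ.+ (2 ℕ.+ m))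
      ≡⟨ count-glue 1 (2 ℕ.+ m) decreasing downUp ⟩
    (N C 1) ℕ.* (1 ℕ.* count downUp (2 ℕ.+ m))
      ≡⟨ cong₂ ℕ._*_ (nC1≡n N) (ℕₚ.*-identityˡ (count downUp (2 ℕ.+ m))) ⟩
    N ℕ.* count downUp (2 ℕ.+ m) ∎
    where
    open ≡-Reasoning
    N = 3 ℕ.+ m

module PowerSeries where

  open import Data.Nat as ℕ using (ℕ; zero; suc; _∸_; _!)
  import Data.Nat.Properties as ℕₚ
  open import Data.Nat.Combinatorics using (_C_; nCk≡n!/k![n-k]!; k![n∸k]!∣n!)
  open import Data.Nat.DivMod using (m/n*n≡m)
  open import Data.Integer as ℤ using (+_)
  open import Data.Rational as ℚ using (ℚ; _+_; _-_; _*_; -_; 0ℚ; 1ℚ; _/_)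
  open import Data.Rational.Properties as ℚₚ using (+-*-commutativeRing)
  import Data.Integer.Properties as ℤₚ
  import Data.Rational.Unnormalised as ℚᵘ
  import Data.Rational.Unnormalised.Properties as ℚᵘₚ
  open import Algebra.Bundles using (CommutativeRing)
  open import Relation.Binary.PropositionalEquality
  open import Defs using (invFact; FPS; _⊕_; _⊗_; sumℚ; cosS; sinS; invList; inv1; secS; tanS; E)
  import Data.List as List
  open import Function using (_∘_; id)
  open import Data.Sum using (inj₁; inj₂)
  open import Algebra.Properties.Group ℚₚ.+-0-group using (∙-cancelˡ; //-rightDividesʳ)
  open import Data.Rational.Solver using (module +-*-Solver)
  open +-*-Solver using (solve; _:=_; _:+_; _:*_; :-_; con)
  open RangeSum (CommutativeRing.commutativeSemiring +-*-commutativeRing) public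
    using (∑; ∑-cong; ∑-zero; ∑-head; ∑-distrib-+; ∑-distribˡ; ∑-distribʳ; ∑-reverse; ∑-triangle)

  ι : ℕ → ℚ
  ι n = + n / 1

  -- The arithmetic of ι is checked on unnormalised representatives, where it reduces to
  -- identities between integers.
  private
    toℚᵘ-ι : ∀ n → ℚ.toℚᵘ (ι n) ℚᵘ.≃ ℚᵘ.mkℚᵘ (+ n) 0
    toℚᵘ-ι n = ℚₚ.toℚᵘ-fromℚᵘ (ℚᵘ.mkℚᵘ (+ n) 0)

  ι-homo-+ : ∀ m n → ι (m ℕ.+ n) ≡ ι m + ι n
  ι-homo-+ m n = ℚₚ.toℚᵘ-injective (ℚᵘₚ.≃-trans (toℚᵘ-ι (m ℕ.+ n)) (ℚᵘₚ.≃-trans ℤ-sum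
    (ℚᵘₚ.≃-sym (ℚᵘₚ.≃-trans (ℚₚ.toℚᵘ-homo-+ (ι m) (ι n)) (ℚᵘₚ.+-cong (toℚᵘ-ι m) (toℚᵘ-ι n))))))
    where
    ℤ-sum : ℚᵘ.mkℚᵘ (+ (m ℕ.+ n)) 0 ℚᵘ.≃ ℚᵘ.mkℚᵘ (+ m) 0 ℚᵘ.+ ℚᵘ.mkℚᵘ (+ n) 0
    ℤ-sum = ℚᵘ.*≡* (begin
      + (m ℕ.+ n) ℤ.* + 1                      ≡⟨ ℤₚ.*-identityʳ _ ⟩
      + (m ℕ.+ n)                              ≡⟨ ℤₚ.pos-+ m n ⟩
      + m ℤ.+ + n                              ≡⟨ sym (cong₂ ℤ._+_ (ℤₚ.*-identityʳ (+ m)) (ℤₚ.*-identityʳ (+ n))) ⟩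
      + m ℤ.* + 1 ℤ.+ + n ℤ.* + 1              ≡⟨ sym (ℤₚ.*-identityʳ _) ⟩
      (+ m ℤ.* + 1 ℤ.+ + n ℤ.* + 1) ℤ.* + 1    ∎)
      where open ≡-Reasoning

  ι-homo-* : ∀ m n → ι (m ℕ.* n) ≡ ι m * ι n
  ι-homo-* zero    n = sym (ℚₚ.*-zeroˡ (ι n))
  ι-homo-* (suc m) n = begin
    ι (n ℕ.+ m ℕ.* n)      ≡⟨ ι-homo-+ n (m ℕ.* n) ⟩
    ι n + ι (m ℕ.* n)      ≡⟨ cong₂ _+_ (sym (ℚₚ.*-identityˡ (ι n))) (ι-homo-* m n) ⟩
    1ℚ * ι n + ι m * ι n   ≡⟨ sym (ℚₚ.*-distribʳ-+ (ι n) 1ℚ (ι m)) ⟩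
    (1ℚ + ι m) * ι n       ≡⟨ cong (_* ι n) (sym (ι-homo-+ 1 m)) ⟩
    ι (suc m) * ι n        ∎
    where open ≡-Reasoning

  ι[m+n]-ιn≡ιm : ∀ m n → ι (m ℕ.+ n) - ι n ≡ ι m
  ι[m+n]-ιn≡ιm m n = trans (cong (_- ι n) (ι-homo-+ m n)) (//-rightDividesʳ (ι n) (ι m))

  1/n*ι-n : ∀ n .{{_ : ℕ.NonZero n}} → (+ 1 / n) * ι n ≡ 1ℚ
  1/n*ι-n (suc k) = ℚₚ.toℚᵘ-injective (ℚᵘₚ.≃-trans (ℚₚ.toℚᵘ-homo-* (+ 1 / suc k) (ι (suc k)))
    (ℚᵘₚ.≃-trans (ℚᵘₚ.*-cong (ℚₚ.toℚᵘ-fromℚᵘ (ℚᵘ.mkℚᵘ (+ 1) k)) (toℚᵘ-ι (suc k)))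
    (ℚᵘₚ.≃-trans (ℚᵘ.*≡* ℤ-eq) (ℚᵘₚ.≃-sym (ℚₚ.toℚᵘ-fromℚᵘ (ℚᵘ.mkℚᵘ (+ 1) 0))))))
    where
    ℤ-eq : (+ 1 ℤ.* + suc k) ℤ.* + 1 ≡ + 1 ℤ.* + (suc k ℕ.* 1)
    ℤ-eq = trans (ℤₚ.*-identityʳ (+ 1 ℤ.* + suc k)) (trans (ℤₚ.*-identityˡ (+ suc k))
             (sym (trans (ℤₚ.*-identityˡ (+ (suc k ℕ.* 1))) (cong +_ (ℕₚ.*-identityʳ (suc k))))))

  invFact-inverse : ∀ n → invFact n * ι (n !) ≡ 1ℚ
  invFact-inverse n = 1/n*ι-n (n !) {{n ℕₚ.!≢0}}

  nCk*k!*[n∸k]!≡n! : ∀ {n k} → k ℕ.≤ n → (n C k) ℕ.* (k ! ℕ.* (n ∸ k) !) ≡ n !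
  nCk*k!*[n∸k]!≡n! {n} {k} k≤n =
    trans (cong (ℕ._* (k ! ℕ.* (n ∸ k) !)) (nCk≡n!/k![n-k]! k≤n)) (m/n*n≡m (k![n∸k]!∣n! k≤n))
    where instance _ = ℕₚ._!*_!≢0 k (n ∸ k)

  invFact-binomial : ∀ {n k} → k ℕ.≤ n → invFact k * invFact (n ∸ k) ≡ ι (n C k) * invFact n
  invFact-binomial {n} {k} k≤n = begin
    a * b                          ≡⟨ sym (ℚₚ.*-identityʳ (a * b)) ⟩
    a * b * 1ℚ                     ≡⟨ cong (a * b *_) (sym c*A*B*i≡1) ⟩
    a * b * (c * A * B * i)        ≡⟨ regroup a b c A B i ⟩
    c * i * (a * A) * (b * B)      ≡⟨ cong₂ (λ x y → c * i * x * y) (invFact-inverse k) (invFact-inverse (n ∸ k)) ⟩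
    c * i * 1ℚ * 1ℚ                ≡⟨ trans (ℚₚ.*-identityʳ _) (ℚₚ.*-identityʳ _) ⟩
    c * i                          ∎
    where
    open ≡-Reasoning
    a = invFact k
    b = invFact (n ∸ k)
    c = ι (n C k)
    A = ι (k !)
    B = ι ((n ∸ k) !)
    i = invFact n
    c*A*B*i≡1 : c * A * B * i ≡ 1ℚ
    c*A*B*i≡1 = begin
      c * A * B * i                      ≡⟨ cong (_* i) (ℚₚ.*-assoc c A B) ⟩
      c * (A * B) * i                    ≡⟨ cong (λ x → c * x * i) (sym (ι-homo-* (k !) ((n ∸ k) !))) ⟩
      c * ι (k ! ℕ.* (n ∸ k) !) * i      ≡⟨ cong (_* i) (sym (ι-homo-* (n C k) _)) ⟩
      ι ((n C k) ℕ.* (k ! ℕ.* (n ∸ k) !)) * i  ≡⟨ cong (λ x → ι x * i) (nCk*k!*[n∸k]!≡n! k≤n) ⟩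
      ι (n !) * i                        ≡⟨ ℚₚ.*-comm (ι (n !)) i ⟩
      i * ι (n !)                        ≡⟨ invFact-inverse n ⟩
      1ℚ                                 ∎
    regroup : ∀ a b c A B i → a * b * (c * A * B * i) ≡ c * i * (a * A) * (b * B)
    regroup = solve 6 (λ a b c A B i → a :* b :* (c :* A :* B :* i) := c :* i :* (a :* A) :* (b :* B)) refl

  infixl 7 _⋆_

  _⋆_ : FPS → FPS → FPS
  (f ⋆ g) n = ∑[ k < suc n ] (f k * g (n ∸ k))

  1ₛ : FPS
  1ₛ zero    = 1ℚ
  1ₛ (suc _) = 0ℚ

  sumℚ-applyUpTo : ∀ n (h : ℕ → ℚ) (g : ℕ → ℕ) → sumℚ (List.map h (List.applyUpTo g n)) ≡ ∑ n (h ∘ g)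
  sumℚ-applyUpTo zero    h g = refl
  sumℚ-applyUpTo (suc n) h g = trans (cong (_+_ (h (g 0))) (sumℚ-applyUpTo n h (g ∘ suc))) (sym (∑-head n (h ∘ g)))

  ⊗≗⋆ : ∀ f g → f ⊗ g ≗ f ⋆ g
  ⊗≗⋆ f g n = sumℚ-applyUpTo (suc n) (λ k → f k * g (n ∸ k)) id

  ⋆-comm : ∀ f g → f ⋆ g ≗ g ⋆ f
  ⋆-comm f g n = trans (∑-reverse n (λ k → f k * g (n ∸ k))) (∑-cong (suc n) λ k k<1+n →
    trans (cong (λ i → f (n ∸ k) * g i) (ℕₚ.m∸[m∸n]≡n (ℕₚ.≤-pred k<1+n))) (ℚₚ.*-comm (f (n ∸ k)) (g k)))

  ⋆-assoc : ∀ f g h → (f ⋆ g) ⋆ h ≗ f ⋆ (g ⋆ h)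
  ⋆-assoc f g h n = begin
    ∑[ k < suc n ] (∑[ i < suc k ] (f i * g (k ∸ i)) * h (n ∸ k))
      ≡⟨ ∑-cong (suc n) (λ k _ → sym (∑-distribʳ (suc k) (h (n ∸ k)) (λ i → f i * g (k ∸ i)))) ⟩
    ∑[ k < suc n ] ∑[ i < suc k ] (f i * g (k ∸ i) * h (n ∸ k))
      ≡⟨ ∑-triangle n (λ i k → f i * g (k ∸ i) * h (n ∸ k)) ⟩
    ∑[ i < suc n ] ∑[ j < suc (n ∸ i) ] (f i * g ((i ℕ.+ j) ∸ i) * h (n ∸ (i ℕ.+ j)))
      ≡⟨ ∑-cong (suc n) (λ i _ → ∑-cong (suc (n ∸ i)) λ j _ →
           trans (cong₂ (λ a b → f i * g a * h b) (ℕₚ.m+n∸m≡n i j) (sym (ℕₚ.∸-+-assoc n i j)))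
                 (ℚₚ.*-assoc (f i) (g j) (h (n ∸ i ∸ j)))) ⟩
    ∑[ i < suc n ] ∑[ j < suc (n ∸ i) ] (f i * (g j * h (n ∸ i ∸ j)))
      ≡⟨ ∑-cong (suc n) (λ i _ → ∑-distribˡ (suc (n ∸ i)) (f i) (λ j → g j * h (n ∸ i ∸ j))) ⟩
    ∑[ i < suc n ] (f i * ∑[ j < suc (n ∸ i) ] (g j * h (n ∸ i ∸ j)))
      ∎
    where open ≡-Reasoning

  ⋆-distribʳ : ∀ f g h → (f ⊕ g) ⋆ h ≗ (f ⋆ h) ⊕ (g ⋆ h)
  ⋆-distribʳ f g h n = trans (∑-cong (suc n) (λ k _ → ℚₚ.*-distribʳ-+ (h (n ∸ k)) (f k) (g k)))
                             (∑-distrib-+ (suc n) (λ k → f k * h (n ∸ k)) (λ k → g k * h (n ∸ k)))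

  ⋆-congˡ : ∀ {f f′} g → f ≗ f′ → f ⋆ g ≗ f′ ⋆ g
  ⋆-congˡ g f≗f′ n = ∑-cong (suc n) (λ k _ → cong (_* g (n ∸ k)) (f≗f′ k))

  ⋆-congʳ : ∀ f {g g′} → g ≗ g′ → f ⋆ g ≗ f ⋆ g′
  ⋆-congʳ f g≗g′ n = ∑-cong (suc n) (λ k _ → cong (f k *_) (g≗g′ (n ∸ k)))

  ⋆-split-last : ∀ f c → c 0 ≡ 1ℚ → ∀ n → (f ⋆ c) n ≡ ∑[ k < n ] (f k * c (n ∸ k)) + f n
  ⋆-split-last f c c0≡1 n = cong (_+_ (∑[ k < n ] (f k * c (n ∸ k)))) (begin
    f n * c (n ∸ n)   ≡⟨ cong (λ i → f n * c i) (ℕₚ.n∸n≡0 n) ⟩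
    f n * c 0         ≡⟨ cong (f n *_) c0≡1 ⟩
    f n * 1ℚ          ≡⟨ ℚₚ.*-identityʳ (f n) ⟩
    f n               ∎)
    where open ≡-Reasoning

  ⋆-identityʳ : ∀ f → f ⋆ 1ₛ ≗ f
  ⋆-identityʳ f n = trans (⋆-split-last f 1ₛ refl n)
    (trans (cong (_+ f n) (∑-zero n (λ k k<n → trans (cong (λ i → f k * 1ₛ i) (ℕₚ.+-∸-assoc 1 k<n)) (ℚₚ.*-zeroʳ (f k)))))
           (ℚₚ.+-identityˡ (f n)))

  ⋆-cancelʳ : ∀ {f g} c → c 0 ≡ 1ℚ → f ⋆ c ≗ g ⋆ c → f ≗ g
  ⋆-cancelʳ {f} {g} c c0≡1 f⋆c≗g⋆c n = agreeBelow (suc n) n ℕₚ.≤-refl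
    where
    agreeBelow : ∀ m k → k ℕ.< m → f k ≡ g k
    agreeBelow (suc m) k k<1+m with ℕₚ.m≤n⇒m<n∨m≡n (ℕₚ.≤-pred k<1+m)
    ... | inj₁ k<m  = agreeBelow m k k<m
    ... | inj₂ refl = ∙-cancelˡ (∑[ i < k ] (f i * c (k ∸ i))) (f k) (g k) (begin
      ∑[ i < k ] (f i * c (k ∸ i)) + f k   ≡⟨ sym (⋆-split-last f c c0≡1 k) ⟩
      (f ⋆ c) k                            ≡⟨ f⋆c≗g⋆c k ⟩
      (g ⋆ c) k                            ≡⟨ ⋆-split-last g c c0≡1 k ⟩
      ∑[ i < k ] (g i * c (k ∸ i)) + g k   ≡⟨ cong (_+ g k) (∑-cong k λ i i<k → cong (_* c (k ∸ i)) (sym (agreeBelow k i i<k))) ⟩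
      ∑[ i < k ] (f i * c (k ∸ i)) + g k   ∎)
      where open ≡-Reasoning

  cosNum : ℕ → ℚ
  cosNum zero          = 1ℚ
  cosNum (suc zero)    = 0ℚ
  cosNum (suc (suc k)) = - cosNum k

  sinNum : ℕ → ℚ
  sinNum zero          = 0ℚ
  sinNum (suc zero)    = 1ℚ
  sinNum (suc (suc k)) = - sinNum k

  private
    two-step : ∀ a b c d → - (a * b) * (c * d) ≡ (- a) * c * (b * d)
    two-step = solve 4 (λ a b c d → :- (a :* b) :* (c :* d) := (:- a) :* c :* (b :* d)) refl

    coefficient-step : ∀ (num : ℕ → ℚ) k → - (num k * invFact k) * (invFact (suc (suc k)) * ι (k !)) ≡ (- num k) * invFact (suc (suc k))
    coefficient-step num k = begin
      - (num k * invFact k) * (invFact (suc (suc k)) * ι (k !))   ≡⟨ two-step (num k) (invFact k) (invFact (suc (suc k))) (ι (k !)) ⟩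
      (- num k) * invFact (suc (suc k)) * (invFact k * ι (k !))   ≡⟨ cong ((- num k) * invFact (suc (suc k)) *_) (invFact-inverse k) ⟩
      (- num k) * invFact (suc (suc k)) * 1ℚ                      ≡⟨ ℚₚ.*-identityʳ _ ⟩
      (- num k) * invFact (suc (suc k))                           ∎
      where open ≡-Reasoning

  cosS-coefficient : ∀ k → cosS k ≡ cosNum k * invFact k
  cosS-coefficient zero          = refl
  cosS-coefficient (suc zero)    = sym (ℚₚ.*-zeroˡ (invFact 1))
  cosS-coefficient (suc (suc k)) =
    trans (cong (λ x → - x * (invFact (suc (suc k)) * ι (k !))) (cosS-coefficient k)) (coefficient-step cosNum k)

  sinS-coefficient : ∀ k → sinS k ≡ sinNum k * invFact k
  sinS-coefficient zero          = sym (ℚₚ.*-zeroˡ (invFact 0))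
  sinS-coefficient (suc zero)    = refl
  sinS-coefficient (suc (suc k)) =
    trans (cong (λ x → - x * (invFact (suc (suc k)) * ι (k !))) (sinS-coefficient k)) (coefficient-step sinNum k)

  sumℚ-invList : ∀ f (g : ℕ → ℚ) (h : ℕ → ℕ) n →
    sumℚ (List.zipWith _*_ (List.map g (List.applyUpTo h (suc n))) (invList f n)) ≡ ∑[ k < suc n ] (g (h k) * inv1 f (n ∸ k))
  sumℚ-invList f g h zero    = trans (ℚₚ.+-identityʳ (g (h 0) * 1ℚ)) (sym (ℚₚ.+-identityˡ (g (h 0) * 1ℚ)))
  sumℚ-invList f g h (suc n) = trans (cong (_+_ (g (h 0) * inv1 f (suc n))) (sumℚ-invList f g (h ∘ suc) n))
                                     (sym (∑-head (suc n) (λ k → g (h k) * inv1 f (suc n ∸ k))))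

  cos⋆sec : cosS ⋆ secS ≗ 1ₛ
  cos⋆sec zero    = refl
  cos⋆sec (suc n) = begin
    (cosS ⋆ secS) (suc n)                                          ≡⟨ ∑-head (suc n) _ ⟩
    cosS 0 * secS (suc n) + ∑[ k < suc n ] (cosS (suc k) * secS (n ∸ k))
      ≡⟨ cong₂ _+_ (ℚₚ.*-identityˡ (secS (suc n))) (sym (sumℚ-invList cosS (cosS ∘ suc) id n)) ⟩
    - X + X                                                        ≡⟨ ℚₚ.+-inverseˡ X ⟩
    0ℚ                                                             ∎
    where
    open ≡-Reasoning
    X = sumℚ (List.zipWith _*_ (List.map (cosS ∘ suc) (List.upTo (suc n))) (invList cosS n))

  secTan⋆cos : (secS ⊕ tanS) ⋆ cosS ≗ 1ₛ ⊕ sinS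
  secTan⋆cos n = begin
    ((secS ⊕ tanS) ⋆ cosS) n                 ≡⟨ ⋆-distribʳ secS tanS cosS n ⟩
    (secS ⋆ cosS) n + (tanS ⋆ cosS) n         ≡⟨ cong₂ _+_ (trans (⋆-comm secS cosS n) (cos⋆sec n)) (⋆-congˡ cosS (⊗≗⋆ sinS secS) n) ⟩
    1ₛ n + ((sinS ⋆ secS) ⋆ cosS) n           ≡⟨ cong (_+_ (1ₛ n)) (⋆-assoc sinS secS cosS n) ⟩
    1ₛ n + (sinS ⋆ (secS ⋆ cosS)) n           ≡⟨ cong (_+_ (1ₛ n)) (⋆-congʳ sinS (λ k → trans (⋆-comm secS cosS k) (cos⋆sec k)) n) ⟩
    1ₛ n + (sinS ⋆ 1ₛ) n                      ≡⟨ cong (_+_ (1ₛ n)) (⋆-identityʳ sinS n) ⟩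
    1ₛ n + sinS n                             ∎
    where open ≡-Reasoning

  CosineBinomial : (ℕ → ℕ) → Set
  CosineBinomial D = ∀ n → ∑[ k < suc n ] (cosNum k * ι ((n C k) ℕ.* D (n ∸ k))) ≡ 1ₛ n + sinNum n

  E-unique : ∀ D → CosineBinomial D → ∀ n → E n ≡ ι (D n)
  E-unique D cosBinomial n = begin
    ι (n !) * (secS ⊕ tanS) n           ≡⟨ cong (ι (n !) *_) (sym (egf≗secTan n)) ⟩
    ι (n !) * (ι (D n) * invFact n)     ≡⟨ rotate (ι (n !)) (ι (D n)) (invFact n) ⟩
    ι (D n) * (invFact n * ι (n !))     ≡⟨ cong (ι (D n) *_) (invFact-inverse n) ⟩
    ι (D n) * 1ℚ                        ≡⟨ ℚₚ.*-identityʳ (ι (D n)) ⟩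
    ι (D n)                             ∎
    where
    open ≡-Reasoning
    egf : FPS
    egf k = ι (D k) * invFact k

    rotate : ∀ a b c → a * (b * c) ≡ b * (c * a)
    rotate = solve 3 (λ a b c → a :* (b :* c) := b :* (c :* a)) refl

    cos⋆egf-term : ∀ m k → k ℕ.≤ m → cosS k * egf (m ∸ k) ≡ invFact m * (cosNum k * ι ((m C k) ℕ.* D (m ∸ k)))
    cos⋆egf-term m k k≤m = begin
      cosS k * (ι (D (m ∸ k)) * invFact (m ∸ k))                 ≡⟨ cong (_* egf (m ∸ k)) (cosS-coefficient k) ⟩
      cosNum k * invFact k * (ι (D (m ∸ k)) * invFact (m ∸ k))   ≡⟨ regroup (cosNum k) (invFact k) (ι (D (m ∸ k))) (invFact (m ∸ k)) ⟩
      cosNum k * ι (D (m ∸ k)) * (invFact k * invFact (m ∸ k))   ≡⟨ cong (cosNum k * ι (D (m ∸ k)) *_) (invFact-binomial k≤m) ⟩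
      cosNum k * ι (D (m ∸ k)) * (ι (m C k) * invFact m)         ≡⟨ regroup′ (cosNum k) (ι (D (m ∸ k))) (ι (m C k)) (invFact m) ⟩
      invFact m * (cosNum k * (ι (m C k) * ι (D (m ∸ k))))       ≡⟨ cong (λ x → invFact m * (cosNum k * x)) (sym (ι-homo-* (m C k) (D (m ∸ k)))) ⟩
      invFact m * (cosNum k * ι ((m C k) ℕ.* D (m ∸ k)))         ∎
      where
      regroup : ∀ c i d j → c * i * (d * j) ≡ c * d * (i * j)
      regroup = solve 4 (λ c i d j → c :* i :* (d :* j) := c :* d :* (i :* j)) refl
      regroup′ : ∀ c d b i → c * d * (b * i) ≡ i * (c * (b * d))
      regroup′ = solve 4 (λ c d b i → c :* d :* (b :* i) := i :* (c :* (b :* d))) refl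

    scale : ∀ m → invFact m * (1ₛ m + sinNum m) ≡ 1ₛ m + sinS m
    scale zero    = refl
    scale (suc m) = begin
      invFact (suc m) * (0ℚ + sinNum (suc m))   ≡⟨ cong (invFact (suc m) *_) (ℚₚ.+-identityˡ (sinNum (suc m))) ⟩
      invFact (suc m) * sinNum (suc m)          ≡⟨ ℚₚ.*-comm (invFact (suc m)) (sinNum (suc m)) ⟩
      sinNum (suc m) * invFact (suc m)          ≡⟨ sym (sinS-coefficient (suc m)) ⟩
      sinS (suc m)                              ≡⟨ sym (ℚₚ.+-identityˡ (sinS (suc m))) ⟩
      0ℚ + sinS (suc m)                         ∎

    egf⋆cos : egf ⋆ cosS ≗ 1ₛ ⊕ sinS
    egf⋆cos m = begin
      (egf ⋆ cosS) m                                                  ≡⟨ ⋆-comm egf cosS m ⟩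
      (cosS ⋆ egf) m                                                  ≡⟨ ∑-cong (suc m) (λ k k<1+m → cos⋆egf-term m k (ℕₚ.≤-pred k<1+m)) ⟩
      ∑[ k < suc m ] (invFact m * (cosNum k * ι ((m C k) ℕ.* D (m ∸ k))))
        ≡⟨ ∑-distribˡ (suc m) (invFact m) (λ k → cosNum k * ι ((m C k) ℕ.* D (m ∸ k))) ⟩
      invFact m * ∑[ k < suc m ] (cosNum k * ι ((m C k) ℕ.* D (m ∸ k)))  ≡⟨ cong (invFact m *_) (cosBinomial m) ⟩
      invFact m * (1ₛ m + sinNum m)                                   ≡⟨ scale m ⟩
      1ₛ m + sinS m                                                   ∎

    egf≗secTan : egf ≗ secS ⊕ tanS
    egf≗secTan = ⋆-cancelʳ cosS refl (λ m → trans (egf⋆cos m) (sym (secTan⋆cos m)))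

module EulerNumbers where

  open import Data.Nat as ℕ using (ℕ; zero; suc; _∸_; _≤_; _<_; s≤s)
  import Data.Nat.Properties as ℕₚ
  open import Data.Nat.Combinatorics using (_C_; nCn≡1)
  open import Data.Rational using (ℚ; _+_; _*_; -_; 0ℚ; 1ℚ)
  import Data.Rational.Properties as ℚₚ
  open import Data.Rational.Solver using (module +-*-Solver)
  open +-*-Solver using (solve; _:=_; _:+_; _:*_; :-_; con)
  open import Relation.Binary.PropositionalEquality
  open import Defs using (sign; E)
  open Patterns
  open PatternCounts using (count-[]≔-free)
  open PowerSeries

  downsThenUpDown : ℕ → Pattern
  downsThenUpDown zero    = upDown
  downsThenUpDown (suc j) = down ∷ᵖ downsThenUpDown j

  glue-[]≔-up : ∀ j → glue decreasing (suc j) downUp [ j ]≔ up ≗ downsThenUpDown j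
  glue-[]≔-up zero    zero    = refl
  glue-[]≔-up zero    (suc i) = refl
  glue-[]≔-up (suc j) zero    = refl
  glue-[]≔-up (suc j) (suc i) = glue-[]≔-up j i

  glue-[]≔-down : ∀ j → glue decreasing (suc j) downUp [ j ]≔ down ≗ downsThenUpDown (suc (suc j))
  glue-[]≔-down zero    zero          = refl
  glue-[]≔-down zero    (suc zero)    = refl
  glue-[]≔-down zero    (suc (suc i)) = refl
  glue-[]≔-down (suc j) zero          = refl
  glue-[]≔-down (suc j) (suc i)       = glue-[]≔-down j i

  count-downsThenUpDown-short : ∀ j n → n ≤ suc j → count (downsThenUpDown j) n ≡ 1
  count-downsThenUpDown-short j zero    _         = refl
  count-downsThenUpDown-short j (suc n) (s≤s n≤j) =
    trans (count-local n (λ k k<n → downs j k (ℕₚ.<-≤-trans k<n n≤j))) (count-decreasing (suc n))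
    where
    downs : ∀ j k → k < j → downsThenUpDown j k ≡ down
    downs (suc j) zero    _         = refl
    downs (suc j) (suc k) (s≤s k<j) = downs j k k<j

  -- (n C j+1) · D (n-j-1) counts the permutations with j descents, a free step and then a
  -- down-up tail; deciding the free step splits them into runs of j and of j+2 descents.
  binomial-step : ∀ n j → suc j < n →
    (n C suc j) ℕ.* count downUp (n ∸ suc j) ≡ count (downsThenUpDown j) n ℕ.+ count (downsThenUpDown (suc (suc j))) n
  binomial-step n j 1+j<n = begin
    (n C suc j) ℕ.* count downUp (n ∸ suc j)
      ≡⟨ cong (λ x → (n C suc j) ℕ.* x) (sym (trans (cong (ℕ._* count downUp (n ∸ suc j)) (count-decreasing (suc j)))
                                                     (ℕₚ.*-identityˡ (count downUp (n ∸ suc j))))) ⟩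
    (n C suc j) ℕ.* (count decreasing (suc j) ℕ.* count downUp (n ∸ suc j))
      ≡⟨ sym (count-glue-≤ decreasing downUp (ℕₚ.<⇒≤ 1+j<n)) ⟩
    count G n
      ≡⟨ count-cong n (λ i → sym ([]≔-unchanged G j free (glue-gap decreasing downUp j) i)) ⟩
    count (G [ j ]≔ free) n
      ≡⟨ count-[]≔-free G j n 1+j<n ⟩
    count (G [ j ]≔ up) n ℕ.+ count (G [ j ]≔ down) n
      ≡⟨ cong₂ ℕ._+_ (count-cong n (glue-[]≔-up j)) (count-cong n (glue-[]≔-down j)) ⟩
    count (downsThenUpDown j) n ℕ.+ count (downsThenUpDown (suc (suc j))) n
      ∎
    where
    open ≡-Reasoning
    G = glue decreasing (suc j) downUp

  double : ℕ → ℕ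
  double zero    = zero
  double (suc i) = suc (suc (double i))

  data Parity : ℕ → Set where
    even : ∀ i → Parity (double i)
    odd  : ∀ i → Parity (suc (double i))

  parity : ∀ n → Parity n
  parity zero    = even zero
  parity (suc n) with parity n
  ... | even i = odd i
  ... | odd  i = even (suc i)

  cosNum-even : ∀ i → cosNum (double i) ≡ sign i
  cosNum-even zero    = refl
  cosNum-even (suc i) = cong -_ (cosNum-even i)

  cosNum-odd : ∀ i → cosNum (suc (double i)) ≡ 0ℚ
  cosNum-odd zero    = refl
  cosNum-odd (suc i) = cong -_ (cosNum-odd i)

  sinNum-even : ∀ i → sinNum (double i) ≡ 0ℚ
  sinNum-even zero    = refl
  sinNum-even (suc i) = cong -_ (sinNum-even i)

  sinNum-odd : ∀ i → sinNum (suc (double i)) ≡ sign i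
  sinNum-odd zero    = refl
  sinNum-odd (suc i) = cong -_ (sinNum-odd i)

  private
    telescope-step : ∀ s a b c → s * a + 0ℚ * b + (- s) * (a + c) ≡ (- s) * c
    telescope-step = solve 4 (λ s a b c → s :* a :+ con 0ℚ :* b :+ (:- s) :* (a :+ c) := (:- s) :* c) refl

    odd-end : ∀ s b → s * 1ℚ + 0ℚ * b ≡ 0ℚ + s
    odd-end = solve 2 (λ s b → s :* con 1ℚ :+ con 0ℚ :* b := con 0ℚ :+ s) refl

    even-end : ∀ s b → s * 1ℚ + 0ℚ * b + (- s) * 1ℚ ≡ 0ℚ + 0ℚ
    even-end = solve 2 (λ s b → s :* con 1ℚ :+ con 0ℚ :* b :+ (:- s) :* con 1ℚ := con 0ℚ :+ con 0ℚ) refl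

  module _ (n : ℕ) where

    cosTerm : ℕ → ℚ
    cosTerm k = cosNum k * ι ((n C k) ℕ.* count downUp (n ∸ k))

    runs : ℕ → ℚ
    runs j = ι (count (downsThenUpDown j) n)

    telescope : ∀ i → suc (double i) ≤ n → ∑[ k < suc (double i) ] cosTerm k ≡ sign i * runs (suc (double i))
    telescope zero    _ = begin
      0ℚ + 1ℚ * ι (1 ℕ.* count downUp n)   ≡⟨ ℚₚ.+-identityˡ _ ⟩
      1ℚ * ι (1 ℕ.* count downUp n)        ≡⟨ cong (λ x → 1ℚ * ι x) (ℕₚ.*-identityˡ (count downUp n)) ⟩
      1ℚ * ι (count downUp n)              ≡⟨ cong (λ x → 1ℚ * ι x) (count-cong n downUp≗down∷upDown) ⟩
      1ℚ * runs 1                          ∎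
      where
      open ≡-Reasoning
      downUp≗down∷upDown : downUp ≗ down ∷ᵖ upDown
      downUp≗down∷upDown zero    = refl
      downUp≗down∷upDown (suc k) = refl
    telescope (suc i) 3+2i≤n = begin
      ∑[ k < suc (double i) ] cosTerm k + cosTerm (suc (double i)) + cosTerm (double (suc i))
        ≡⟨ cong₂ (λ x y → x + y * B + cosTerm (double (suc i))) (telescope i (ℕₚ.m+n≤o⇒n≤o 2 3+2i≤n)) (cosNum-odd i) ⟩
      sign i * runs (suc (double i)) + 0ℚ * B + (- cosNum (double i)) * ι ((n C double (suc i)) ℕ.* count downUp (n ∸ double (suc i)))
        ≡⟨ cong₂ (λ x y → sign i * runs (suc (double i)) + 0ℚ * B + (- x) * y) (cosNum-even i)
             (trans (cong ι (binomial-step n (suc (double i)) 3+2i≤n))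
                    (ι-homo-+ (count (downsThenUpDown (suc (double i))) n) (count (downsThenUpDown (suc (double (suc i)))) n))) ⟩
      sign i * runs (suc (double i)) + 0ℚ * B + (- sign i) * (runs (suc (double i)) + runs (suc (double (suc i))))
        ≡⟨ telescope-step (sign i) (runs (suc (double i))) B (runs (suc (double (suc i)))) ⟩
      sign (suc i) * runs (suc (double (suc i))) ∎
      where
      open ≡-Reasoning
      B = ι ((n C suc (double i)) ℕ.* count downUp (n ∸ suc (double i)))

  count-downUp-cosineBinomial : CosineBinomial (count downUp)
  count-downUp-cosineBinomial n with parity n
  ... | even zero    = refl
  ... | odd i        = begin
    ∑[ k < suc (double i) ] cosTerm n k + cosTerm n n
      ≡⟨ cong₂ (λ x y → x + y * B) (telescope n i ℕₚ.≤-refl) (cosNum-odd i) ⟩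
    sign i * runs n n + 0ℚ * B
      ≡⟨ cong (λ x → sign i * ι x + 0ℚ * B) (count-downsThenUpDown-short n n (ℕₚ.n≤1+n n)) ⟩
    sign i * 1ℚ + 0ℚ * B
      ≡⟨ odd-end (sign i) B ⟩
    0ℚ + sign i
      ≡⟨ cong (0ℚ +_) (sym (sinNum-odd i)) ⟩
    0ℚ + sinNum n ∎
    where
    open ≡-Reasoning
    B = ι ((n C n) ℕ.* count downUp (n ∸ n))
  ... | even (suc i) = begin
    ∑[ k < suc (double i) ] cosTerm n k + cosTerm n (suc (double i)) + cosTerm n n
      ≡⟨ cong₂ (λ x y → x + y * B + cosTerm n n) (telescope n i (ℕₚ.n≤1+n _)) (cosNum-odd i) ⟩
    sign i * runs n (suc (double i)) + 0ℚ * B + (- cosNum (double i)) * ι ((n C n) ℕ.* count downUp (n ∸ n))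
      ≡⟨ cong₂ (λ x y → sign i * x + 0ℚ * B + (- y) * ι ((n C n) ℕ.* count downUp (n ∸ n)))
           (cong ι (count-downsThenUpDown-short (suc (double i)) n ℕₚ.≤-refl)) (cosNum-even i) ⟩
    sign i * 1ℚ + 0ℚ * B + (- sign i) * ι ((n C n) ℕ.* count downUp (n ∸ n))
      ≡⟨ cong (λ x → sign i * 1ℚ + 0ℚ * B + (- sign i) * ι x)
           (cong₂ ℕ._*_ (nCn≡1 n) (cong (count downUp) (ℕₚ.n∸n≡0 n))) ⟩
    sign i * 1ℚ + 0ℚ * B + (- sign i) * 1ℚ
      ≡⟨ even-end (sign i) B ⟩
    0ℚ + 0ℚ
      ≡⟨ cong (0ℚ +_) (sym (sinNum-even (suc i))) ⟩
    0ℚ + sinNum n ∎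
    where
    open ≡-Reasoning
    B = ι ((n C suc (double i)) ℕ.* count downUp (n ∸ suc (double i)))

  E≡count-downUp : ∀ n → E n ≡ ι (count downUp n)
  E≡count-downUp = E-unique (count downUp) count-downUp-cosineBinomial

import Data.Nat as ℕ
open import Relation.Binary.PropositionalEquality using (sym; cong; cong₂; module ≡-Reasoning)
open Patterns using (count; downUp)
open PatternCounts using (cardA231-recurrence)
open PowerSeries using (ι; ι[m+n]-ιn≡ιm; ι-homo-*)
open EulerNumbers using (E≡count-downUp)

open import Defs
open import Data.Nat using (ℕ; _+_)
open import Data.Integer using (+_)
open import Data.Rational using (ℚ; _/_; _*_; _-_)
open import Relation.Binary.PropositionalEquality using (_≡_)

mainTheorem2 : (m : ℕ) →
    (+ cardA231 m) / 1 ≡ ((+ (3 + m)) / 1) * E (2 + m) - E (3 + m)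
mainTheorem2 m = begin
  ι a                                ≡⟨ sym (ι[m+n]-ιn≡ιm a D₃) ⟩
  ι (a + D₃) - ι D₃                  ≡⟨ cong (λ x → ι x - ι D₃) (cardA231-recurrence m) ⟩
  ι ((3 + m) ℕ.* D₂) - ι D₃          ≡⟨ cong (_- ι D₃) (ι-homo-* (3 + m) D₂) ⟩
  ι (3 + m) * ι D₂ - ι D₃
    ≡⟨ sym (cong₂ (λ x y → ι (3 + m) * x - y) (E≡count-downUp (2 + m)) (E≡count-downUp (3 + m))) ⟩
  ι (3 + m) * E (2 + m) - E (3 + m)  ∎
  where
  open ≡-Reasoning
  a  = cardA231 m
  D₂ = count downUp (2 + m)
  D₃ = count downUp (3 + m)
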